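{- Let $r\ge -1$, $k\ge0$ and integers $1\le a_1\le\dots\le a_k\le r$ with $a_i-a_{i-1}\ge2$ for $2\le i\le k$. Then: (1) (with $k=0$) $q(-1)=1$ and $q(0)=0$; (2) if $r-a_k\ge2$ (or if $r\ge2$ and $k=0$), then $q(r;a_1,\dots,a_k)=-q(r-2;a_1,\dots,a_k)$; (3) if $r-a_k=1$, then $q(r;a_1,\dots,a_k)=q(r-2;a_1,\dots,a_{k-1})+2q(r-3;a_1,\dots,a_{k-1})$; (4) if $r=a_k$, then $q(r;a_1,\dots,a_k)=-2q(r-1;a_1,\dots,a_{k-1})-3q(r-2;a_1,\dots,a_{k-1})$.
   Context: All graphs are finite and simple. For an edge $uv$ of a graph, adding a $2$-house to $uv$ means adding two new vertices $x,y$ and all edges among $\{u,v,x,y\}$ (so these four vertices induce $K_4$). For $r\ge0$, $k\ge0$ and $a_1,\dots,a_k$ as in the claim, $Q(r;a_1,\dots,a_k)$ is the graph obtained from a path with $r$ edges (and $r+1$ vertices) by adding a $2$-house on the $a_i$-th edge of the path for each $i$; $Q(-1)$ denotes the graph with no vertices. An elementary subgraph of a graph is a subgraph each of whose connected components is a cycle or a single edge; it is spanning if it contains all vertices. For an elementary subgraph $X$ with $c$ edge-components and $d$ cycle-components, $\beta(X)=(-1)^c(-2)^d$. Then $q(r;a_1,\dots,a_k)$ is the sum of $\beta(X)$ over all spanning elementary subgraphs $X$ of $Q(r;a_1,\dots,a_k)$ (for the empty graph, the empty subgraph is the unique spanning elementary subgraph). -}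

module Defs where

open import Data.Nat as ℕ using (ℕ; zero; suc; _≡ᵇ_; _≤ᵇ_; _∸_)
open import Data.Bool using (Bool; true; false; _∧_; _∨_; if_then_else_)
open import Data.List using (List; []; _∷_; [_]; _++_; map; length; filterᵇ; upTo; foldr)
open import Data.Bool.ListAction using (all; any)
open import Data.Product using (_×_; _,_; proj₁; proj₂)
open import Data.Integer as ℤ using (ℤ; +_; -[1+_]; _^_)
open import Function using (_∘_)

-- Finite simple graphs: vertex set {0,…,n-1}, edges as a list of
-- (unordered) pairs.

record Graph : Set where
  constructor mkGraph
  field
    nV : ℕ
    E  : List (ℕ × ℕ)
open Graph public

emptyGraph : Graph
emptyGraph = mkGraph 0 []

-- QP m as: path with m vertices 0,…,m-1 (so r = m-1 edges;
-- m = 0 is the empty graph Q(-1)); the j-th edge of the path (j ≥ 1) is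
-- {j-1, j}.  For the i-th entry a of `as` (i = 0,1,…) a 2-house with new
-- vertices x = m+2i, y = m+2i+1 is added on the a-th edge {a-1, a}.

pathEdges : ℕ → List (ℕ × ℕ)
pathEdges m = map (λ j → (j , suc j)) (upTo (m ∸ 1))

houseEdges : ℕ → ℕ → List ℕ → List (ℕ × ℕ)
houseEdges m i [] = []
houseEdges m i (a ∷ as) =
  let u = a ∸ 1 ; v = a ; x = m ℕ.+ (2 ℕ.* i) ; y = suc x in
  (u , x) ∷ (u , y) ∷ (v , x) ∷ (v , y) ∷ (x , y) ∷ houseEdges m (suc i) as

QP : ℕ → List ℕ → Graph
QP m as = mkGraph (m ℕ.+ 2 ℕ.* length as) (pathEdges m ++ houseEdges m 0 as)

Q : ℤ → List ℕ → Graph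
Q (+ r)    as = QP (suc r) as
Q -[1+ _ ] as = emptyGraph

subsets : {A : Set} → List A → List (List A)
subsets [] = [ [] ]
subsets (x ∷ xs) = let s = subsets xs in s ++ map (x ∷_) s

adj : List (ℕ × ℕ) → ℕ → ℕ → Bool
adj S u v = any (λ e → ((proj₁ e ≡ᵇ u) ∧ (proj₂ e ≡ᵇ v)) ∨ ((proj₁ e ≡ᵇ v) ∧ (proj₂ e ≡ᵇ u))) S

incident : ℕ → ℕ × ℕ → Bool
incident v e = (proj₁ e ≡ᵇ v) ∨ (proj₂ e ≡ᵇ v)

deg : List (ℕ × ℕ) → ℕ → ℕ
deg S v = length (filterᵇ (incident v) S)

mem : ℕ → List ℕ → Bool
mem v = any (v ≡ᵇ_)

step : ℕ → List (ℕ × ℕ) → List ℕ → List ℕ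
step n S C = filterᵇ (λ w → any (λ u → (u ≡ᵇ w) ∨ adj S u w) C) (upTo n)

iter : ℕ → (List ℕ → List ℕ) → List ℕ → List ℕ
iter zero f C = C
iter (suc k) f C = iter k f (f C)

comp : ℕ → List (ℕ × ℕ) → ℕ → List ℕ
comp n S v = iter n (step n S) [ v ]

-- v is the chosen representative (its smallest vertex) of its component
isRep : ℕ → List (ℕ × ℕ) → ℕ → Bool
isRep n S v = all (v ≤ᵇ_) (comp n S v)

reps : ℕ → List (ℕ × ℕ) → List ℕ
reps n S = filterᵇ (isRep n S) (upTo n)

compEdges : List (ℕ × ℕ) → List ℕ → List (ℕ × ℕ)
compEdges S C = filterᵇ (λ e → mem (proj₁ e) C) S

isEdgeComp : ℕ → List (ℕ × ℕ) → ℕ → Bool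
isEdgeComp n S v = (length (comp n S v) ≡ᵇ 2) ∧ (length (compEdges S (comp n S v)) ≡ᵇ 1)

isCycleComp : ℕ → List (ℕ × ℕ) → ℕ → Bool
isCycleComp n S v = (3 ≤ᵇ length (comp n S v)) ∧ all (λ w → deg S w ≡ᵇ 2) (comp n S v)

isElementary : ℕ → List (ℕ × ℕ) → Bool
isElementary n S = all (λ v → isEdgeComp n S v ∨ isCycleComp n S v) (reps n S)

count : {A : Set} → (A → Bool) → List A → ℕ
count p xs = length (filterᵇ p xs)

β : ℕ → List (ℕ × ℕ) → ℤ
β n S = (ℤ.- ℤ.1ℤ) ^ count (isEdgeComp n S) (reps n S)
        ℤ.* (ℤ.- (+ 2)) ^ count (isCycleComp n S) (reps n S)

sumℤ : List ℤ → ℤ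
sumℤ = foldr ℤ._+_ ℤ.0ℤ

qG : Graph → ℤ
qG G = sumℤ (map (λ S → if isElementary (nV G) S then β (nV G) S else ℤ.0ℤ) (subsets (E G)))

q : ℤ → List ℕ → ℤ
q r as = qG (Q r as)

data Gaps : List ℕ → Set where
  g0 : Gaps []
  g1 : ∀ a → Gaps [ a ]
  g2 : ∀ a b as → a ℕ.+ 2 ℕ.≤ b → Gaps (b ∷ as) → Gaps (a ∷ b ∷ as)

data InRange (r : ℤ) : List ℕ → Set where
  ir0 : InRange r []
  ir1 : ∀ a as → 1 ℕ.≤ a → + a ℤ.≤ r → InRange r as → InRange r (a ∷ as)

Admissible : ℤ → List ℕ → Set
Admissible r as = (-[1+ 0 ] ℤ.≤ r) × InRange r as × Gaps as

{-# OPTIONS --safe #-}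
module Submission where

-- Cut Q at a path vertex c beyond which only a small end piece remains: the last edge, the last
-- 2-house followed by the last edge, or the last 2-house alone. A spanning elementary subgraph either
-- covers c by edges of the end piece, and then it has no edge from c back to the path and splits into
-- spanning elementary subgraphs of the end piece and of the part left of c; or it does not, and then
-- it splits into spanning elementary subgraphs of the end piece without c and of the part left of c
-- together with c. As β is multiplicative, q(Q) = κ·q(left of c) + λ·q(left of c, with c), where κ and
-- λ are the corresponding sums over the end piece alone: (−1, 0) for an edge, (2, 1) for a 2-house
-- followed by an edge, and (−3, −2) for a 2-house.

module ElementarySums where

  open import Data.Nat using (ℕ; zero; suc; _+_; _≡ᵇ_; _≤ᵇ_; _<_; _≤_; z≤n; s≤s)
  import Data.Nat.Properties as ℕₚ
  open import Data.Bool using (Bool; true; false; _∧_; _∨_; not; if_then_else_; T)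
  import Data.Bool.Properties as Boolₚ
  open import Data.Bool.ListAction using (all; any)
  open import Data.Unit using (tt)
  open import Data.Product using (_×_; _,_; proj₁; proj₂; ∃-syntax)
  open import Data.Sum using (_⊎_; inj₁; inj₂)
  open import Data.List using (List; []; _∷_; [_]; _++_; map; length; filterᵇ; upTo)
  import Data.List.Properties as Listₚ
  import Data.List.Extrema ℕₚ.≤-totalOrder as Extrema
  open import Data.List.Membership.Propositional using (_∈_; _∉_)
  open import Data.List.Membership.Propositional.Properties using (∈-map⁺; ∈-map⁻; ∈-++⁺ˡ; ∈-++⁺ʳ; ∈-++⁻)
  open import Data.List.Relation.Unary.Any using (here; there)
  import Data.List.Relation.Unary.All as All
  open import Data.List.Relation.Binary.Permutation.Propositional as ↭ using (_↭_; ↭-trans)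
  import Data.List.Relation.Binary.Permutation.Propositional.Properties as ↭ₚ
  open import Data.Integer as ℤ using (ℤ; +_; _^_)
  import Data.Integer.Properties as ℤₚ
  import Algebra.Properties.CommutativeSemigroup ℤₚ.+-commutativeSemigroup as ℤ+
  open import Function using (_∘_; id)
  open import Relation.Binary.PropositionalEquality hiding ([_])
  open import Relation.Binary.Definitions using (tri<; tri≈; tri>)
  open import Relation.Nullary using (contradiction)
  open import Defs

  private variable
    A B : Set

  ≡ᵇ⇒≡ : ∀ {m n} → (m ≡ᵇ n) ≡ true → m ≡ n
  ≡ᵇ⇒≡ {m} {n} e = ℕₚ.≡ᵇ⇒≡ m n (subst T (sym e) tt)

  ≡ᵇ-refl : ∀ n → (n ≡ᵇ n) ≡ true
  ≡ᵇ-refl zero = refl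
  ≡ᵇ-refl (suc n) = ≡ᵇ-refl n

  ≢⇒≡ᵇ-false : ∀ {m n} → m ≢ n → (m ≡ᵇ n) ≡ false
  ≢⇒≡ᵇ-false {m} {n} m≢n with m ≡ᵇ n in eq
  ... | true = contradiction (≡ᵇ⇒≡ eq) m≢n
  ... | false = refl

  ≤ᵇ⇒≤ : ∀ {m n} → (m ≤ᵇ n) ≡ true → m ≤ n
  ≤ᵇ⇒≤ {m} {n} e = ℕₚ.≤ᵇ⇒≤ m n (subst T (sym e) tt)

  ≤⇒≤ᵇ : ∀ {m n} → m ≤ n → (m ≤ᵇ n) ≡ true
  ≤⇒≤ᵇ {m} {n} m≤n with m ≤ᵇ n in eq
  ... | true = refl
  ... | false = contradiction (ℕₚ.≤⇒≤ᵇ m≤n) (subst T eq)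

  not-≡ᵇ⇒≢ : ∀ {m n} → not (m ≡ᵇ n) ≡ true → m ≢ n
  not-≡ᵇ⇒≢ {m} h refl = contradiction (trans (sym h) (cong not (≡ᵇ-refl m))) λ ()

  ∨-true⁻ : ∀ {a b} → (a ∨ b) ≡ true → a ≡ true ⊎ b ≡ true
  ∨-true⁻ {true} e = inj₁ refl
  ∨-true⁻ {false} e = inj₂ e

  ∨-false⁻ʳ : ∀ {a b} → (a ∨ b) ≡ false → b ≡ false
  ∨-false⁻ʳ {false} e = e

  ∧-true⁻ : ∀ {a b} → (a ∧ b) ≡ true → a ≡ true × b ≡ true
  ∧-true⁻ {true} {true} e = refl , refl

  ∧-falseʳ : ∀ a {b} → b ≡ false → (a ∧ b) ≡ false
  ∧-falseʳ a refl = Boolₚ.∧-zeroʳ a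

  ⇒-not-∨ : ∀ {a b} → (a ≡ true → b ≡ true) → (not a ∨ b) ≡ true
  ⇒-not-∨ {true} f = f refl
  ⇒-not-∨ {false} f = refl

  ⇔⇒≡ : ∀ {a b} → (a ≡ true → b ≡ true) → (b ≡ true → a ≡ true) → a ≡ b
  ⇔⇒≡ {true} {true} f g = refl
  ⇔⇒≡ {true} {false} f g = sym (f refl)
  ⇔⇒≡ {false} {true} f g = g refl
  ⇔⇒≡ {false} {false} f g = refl

  any⁺ : (p : A → Bool) {x : A} {xs : List A} → x ∈ xs → p x ≡ true → any p xs ≡ true
  any⁺ p {xs = y ∷ ys} (here refl) e rewrite e = refl
  any⁺ p {xs = y ∷ ys} (there m) e = trans (cong (p y ∨_) (any⁺ p m e)) (Boolₚ.∨-zeroʳ (p y))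

  any⁻ : (p : A → Bool) (xs : List A) → any p xs ≡ true → ∃[ x ] (x ∈ xs × p x ≡ true)
  any⁻ p (y ∷ ys) e with p y in eq
  ... | true = y , here refl , eq
  ... | false with any⁻ p ys e
  ...   | x , m , px = x , there m , px

  all⁺ : (p : A → Bool) (xs : List A) → (∀ x → x ∈ xs → p x ≡ true) → all p xs ≡ true
  all⁺ p [] f = refl
  all⁺ p (y ∷ ys) f rewrite f y (here refl) = all⁺ p ys (λ x m → f x (there m))

  all⁻ : (p : A → Bool) {x : A} {xs : List A} → all p xs ≡ true → x ∈ xs → p x ≡ true
  all⁻ p {xs = y ∷ ys} e (here refl) = proj₁ (∧-true⁻ e)
  all⁻ p {xs = y ∷ ys} e (there m) = all⁻ p (proj₂ (∧-true⁻ {p y} e)) m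

  all-false⁺ : (p : A → Bool) {x : A} {xs : List A} → x ∈ xs → p x ≡ false → all p xs ≡ false
  all-false⁺ p {xs = y ∷ ys} (here refl) e rewrite e = refl
  all-false⁺ p {xs = y ∷ ys} (there m) e = ∧-falseʳ (p y) (all-false⁺ p m e)

  all-false⁻ : (p : A → Bool) (xs : List A) → all p xs ≡ false → ∃[ x ] (x ∈ xs × p x ≡ false)
  all-false⁻ p (y ∷ ys) e with p y in eq
  ... | false = y , here refl , eq
  ... | true with all-false⁻ p ys e
  ...   | x , m , px = x , there m , px

  all-cong : (p q : A → Bool) (xs : List A) → (∀ x → x ∈ xs → p x ≡ q x) → all p xs ≡ all q xs
  all-cong p q [] f = refl
  all-cong p q (y ∷ ys) f = cong₂ _∧_ (f y (here refl)) (all-cong p q ys (λ x m → f x (there m)))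

  any-cong : (p q : A → Bool) (xs : List A) → (∀ x → x ∈ xs → p x ≡ q x) → any p xs ≡ any q xs
  any-cong p q [] f = refl
  any-cong p q (y ∷ ys) f = cong₂ _∨_ (f y (here refl)) (any-cong p q ys (λ x m → f x (there m)))

  all-++ : (p : A → Bool) (xs ys : List A) → all p (xs ++ ys) ≡ (all p xs ∧ all p ys)
  all-++ p [] ys = refl
  all-++ p (x ∷ xs) ys rewrite all-++ p xs ys = sym (Boolₚ.∧-assoc (p x) (all p xs) (all p ys))

  any-++ : (p : A → Bool) (xs ys : List A) → any p (xs ++ ys) ≡ (any p xs ∨ any p ys)
  any-++ p [] ys = refl
  any-++ p (x ∷ xs) ys rewrite any-++ p xs ys = sym (Boolₚ.∨-assoc (p x) (any p xs) (any p ys))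

  all-map : (p : B → Bool) (f : A → B) (xs : List A) → all p (map f xs) ≡ all (λ x → p (f x)) xs
  all-map p f [] = refl
  all-map p f (x ∷ xs) = cong (p (f x) ∧_) (all-map p f xs)

  any-map : (p : B → Bool) (f : A → B) (xs : List A) → any p (map f xs) ≡ any (λ x → p (f x)) xs
  any-map p f [] = refl
  any-map p f (x ∷ xs) = cong (p (f x) ∨_) (any-map p f xs)

  all-↭ : (p : A → Bool) {xs ys : List A} → xs ↭ ys → all p xs ≡ all p ys
  all-↭ p ↭.refl = refl
  all-↭ p (↭.prep x r) = cong (p x ∧_) (all-↭ p r)
  all-↭ p (↭.swap x y r) rewrite all-↭ p r with p x | p y
  ... | true | true = refl
  ... | true | false = refl
  ... | false | true = refl
  ... | false | false = refl
  all-↭ p (↭.trans r s) = trans (all-↭ p r) (all-↭ p s)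

  any-↭ : (p : A → Bool) {xs ys : List A} → xs ↭ ys → any p xs ≡ any p ys
  any-↭ p ↭.refl = refl
  any-↭ p (↭.prep x r) = cong (p x ∨_) (any-↭ p r)
  any-↭ p (↭.swap x y r) rewrite any-↭ p r with p x | p y
  ... | true | true = refl
  ... | true | false = refl
  ... | false | true = refl
  ... | false | false = refl
  any-↭ p (↭.trans r s) = trans (any-↭ p r) (any-↭ p s)

  filter-∷ : (p : A → Bool) (x : A) (xs : List A) →
    filterᵇ p (x ∷ xs) ≡ (if p x then x ∷ filterᵇ p xs else filterᵇ p xs)
  filter-∷ p x xs with p x
  ... | true = refl
  ... | false = refl

  filter-cong : (p q : A → Bool) (xs : List A) → (∀ x → x ∈ xs → p x ≡ q x) → filterᵇ p xs ≡ filterᵇ q xs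
  filter-cong p q [] f = refl
  filter-cong p q (y ∷ ys) f rewrite filter-∷ p y ys | filter-∷ q y ys | f y (here refl)
    | filter-cong p q ys (λ x m → f x (there m)) = refl

  ∈-filter⁻ : (p : A → Bool) {x : A} (xs : List A) → x ∈ filterᵇ p xs → x ∈ xs × p x ≡ true
  ∈-filter⁻ p (y ∷ ys) m with p y in eq
  ∈-filter⁻ p (y ∷ ys) (here refl) | true = here refl , eq
  ∈-filter⁻ p (y ∷ ys) (there m) | true = let (a , b) = ∈-filter⁻ p ys m in there a , b
  ∈-filter⁻ p (y ∷ ys) m | false = let (a , b) = ∈-filter⁻ p ys m in there a , b

  ∈-filter⁺ : (p : A → Bool) {x : A} (xs : List A) → x ∈ xs → p x ≡ true → x ∈ filterᵇ p xs
  ∈-filter⁺ p (y ∷ ys) m px with p y in eq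
  ∈-filter⁺ p (y ∷ ys) (here refl) px | true = here refl
  ∈-filter⁺ p (y ∷ ys) (there m) px | true = there (∈-filter⁺ p ys m px)
  ∈-filter⁺ p (y ∷ ys) (here refl) px | false = contradiction (trans (sym eq) px) λ ()
  ∈-filter⁺ p (y ∷ ys) (there m) px | false = ∈-filter⁺ p ys m px

  all-filter : (p q : A → Bool) (xs : List A) → all p (filterᵇ q xs) ≡ all (λ x → not (q x) ∨ p x) xs
  all-filter p q [] = refl
  all-filter p q (x ∷ xs) rewrite filter-∷ q x xs with q x
  ... | true = cong (p x ∧_) (all-filter p q xs)
  ... | false = all-filter p q xs

  count-∷ : (p : A → Bool) (x : A) (xs : List A) →
    count p (x ∷ xs) ≡ (if p x then suc (count p xs) else count p xs)
  count-∷ p x xs with p x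
  ... | true = refl
  ... | false = refl

  count-cong : (p q : A → Bool) (xs : List A) → (∀ x → x ∈ xs → p x ≡ q x) → count p xs ≡ count q xs
  count-cong p q xs f = cong length (filter-cong p q xs f)

  count-++ : (p : A → Bool) (xs ys : List A) → count p (xs ++ ys) ≡ count p xs + count p ys
  count-++ p xs ys = trans (cong length (Listₚ.filter-++ _ xs ys)) (Listₚ.length-++ (filterᵇ p xs))

  count-map : (p : B → Bool) (f : A → B) (xs : List A) → count p (map f xs) ≡ count (λ x → p (f x)) xs
  count-map p f [] = refl
  count-map p f (x ∷ xs) rewrite count-∷ p (f x) (map f xs) | count-∷ (λ x → p (f x)) x xs
    | count-map p f xs = refl

  count-filter : (p q : A → Bool) (xs : List A) → count p (filterᵇ q xs) ≡ count (λ x → q x ∧ p x) xs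
  count-filter p q [] = refl
  count-filter p q (x ∷ xs) rewrite filter-∷ q x xs | count-∷ (λ x → q x ∧ p x) x xs with q x
  ... | true rewrite count-∷ p x (filterᵇ q xs) | count-filter p q xs = refl
  ... | false = count-filter p q xs

  count-zero : (p : A → Bool) (xs : List A) → (∀ x → x ∈ xs → p x ≡ false) → count p xs ≡ 0
  count-zero p [] f = refl
  count-zero p (y ∷ ys) f rewrite count-∷ p y ys | f y (here refl) = count-zero p ys (λ x m → f x (there m))

  count-≤-length : (p : A → Bool) (xs : List A) → count p xs ≤ length xs
  count-≤-length p = Listₚ.length-filter _

  count-mono : (p q : A → Bool) (xs : List A) → (∀ x → x ∈ xs → p x ≡ true → q x ≡ true) → count p xs ≤ count q xs
  count-mono p q [] f = z≤n
  count-mono p q (y ∷ ys) f rewrite count-∷ p y ys | count-∷ q y ys with p y in ep | q y in eq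
  ... | true | true = s≤s (count-mono p q ys (λ x m → f x (there m)))
  ... | true | false = contradiction (trans (sym eq) (f y (here refl) ep)) λ ()
  ... | false | true = ℕₚ.m≤n⇒m≤1+n (count-mono p q ys (λ x m → f x (there m)))
  ... | false | false = count-mono p q ys (λ x m → f x (there m))

  count-< : (p q : A → Bool) (xs : List A) → (∀ x → x ∈ xs → p x ≡ true → q x ≡ true) →
    ∀ {z} → z ∈ xs → p z ≡ false → q z ≡ true → count p xs < count q xs
  count-< p q (y ∷ ys) f (here refl) pz qz rewrite count-∷ p y ys | count-∷ q y ys | pz | qz =
    s≤s (count-mono p q ys (λ x m → f x (there m)))
  count-< p q (y ∷ ys) f (there zm) pz qz rewrite count-∷ p y ys | count-∷ q y ys with p y in ep | q y in eq
  ... | true | true = s≤s (count-< p q ys (λ x m → f x (there m)) zm pz qz)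
  ... | true | false = contradiction (trans (sym eq) (f y (here refl) ep)) λ ()
  ... | false | true = ℕₚ.m≤n⇒m≤1+n (count-< p q ys (λ x m → f x (there m)) zm pz qz)
  ... | false | false = count-< p q ys (λ x m → f x (there m)) zm pz qz

  count-pos : (p : A → Bool) {z : A} (xs : List A) → z ∈ xs → p z ≡ true → 1 ≤ count p xs
  count-pos p xs m pz = ℕₚ.≤-trans (s≤s z≤n) (count-< (λ _ → false) p xs (λ _ _ ()) m refl pz)

  count-↭ : (p : A → Bool) {xs ys : List A} → xs ↭ ys → count p xs ≡ count p ys
  count-↭ p ↭.refl = refl
  count-↭ p (↭.prep {xs = xs} {ys = ys} x r) rewrite count-∷ p x xs | count-∷ p x ys | count-↭ p r = refl
  count-↭ p (↭.swap {xs = xs} {ys = ys} x y r) rewrite count-∷ p x (y ∷ xs) | count-∷ p y (x ∷ ys)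
    | count-∷ p y xs | count-∷ p x ys | count-↭ p r with p x | p y
  ... | true | true = refl
  ... | true | false = refl
  ... | false | true = refl
  ... | false | false = refl
  count-↭ p (↭.trans r s) = trans (count-↭ p r) (count-↭ p s)

  ∈⇒mem : ∀ {v xs} → v ∈ xs → mem v xs ≡ true
  ∈⇒mem {v} m = any⁺ (v ≡ᵇ_) m (≡ᵇ-refl v)

  mem⇒∈ : ∀ {v} xs → mem v xs ≡ true → v ∈ xs
  mem⇒∈ {v} xs e with any⁻ (v ≡ᵇ_) xs e
  ... | x , m , eq rewrite ≡ᵇ⇒≡ {v} {x} eq = m

  ∉⇒mem-false : ∀ {v} xs → v ∉ xs → mem v xs ≡ false
  ∉⇒mem-false {v} xs v∉ with mem v xs in eq
  ... | true = contradiction (mem⇒∈ xs eq) v∉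
  ... | false = refl

  mem-filter : ∀ (p : ℕ → Bool) w xs → mem w (filterᵇ p xs) ≡ (p w ∧ mem w xs)
  mem-filter p w xs = ⇔⇒≡
    (λ e → let (a , b) = ∈-filter⁻ p xs (mem⇒∈ (filterᵇ p xs) e) in
           subst (λ z → (z ∧ mem w xs) ≡ true) (sym b) (∈⇒mem a))
    (λ e → let (a , b) = ∧-true⁻ {p w} e in ∈⇒mem (∈-filter⁺ p xs (mem⇒∈ xs b) a))

  mem-↭ : ∀ {v xs ys} → xs ↭ ys → mem v xs ≡ mem v ys
  mem-↭ {v} = any-↭ (v ≡ᵇ_)

  mem-++ : ∀ v xs ys → mem v (xs ++ ys) ≡ (mem v xs ∨ mem v ys)
  mem-++ v = any-++ (v ≡ᵇ_)

  mem-++ˡ : ∀ z xs ys → mem z xs ≡ true → mem z (xs ++ ys) ≡ true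
  mem-++ˡ z xs ys e rewrite mem-++ z xs ys | e = refl

  mem-++ʳ : ∀ z xs ys → mem z ys ≡ true → mem z (xs ++ ys) ≡ true
  mem-++ʳ z xs ys e rewrite mem-++ z xs ys | e = Boolₚ.∨-zeroʳ (mem z xs)

  mem-∷⁺ʳ : ∀ z y xs → mem z xs ≡ true → mem z (y ∷ xs) ≡ true
  mem-∷⁺ʳ z y xs e rewrite e = Boolₚ.∨-zeroʳ (z ≡ᵇ y)

  mem-single : ∀ {z v} → mem z [ v ] ≡ true → z ≡ v
  mem-single {z} {v} e with z ≡ᵇ v in eq
  ... | true = ≡ᵇ⇒≡ eq

  sumℤ-++ : ∀ xs ys → sumℤ (xs ++ ys) ≡ sumℤ xs ℤ.+ sumℤ ys
  sumℤ-++ [] ys = sym (ℤₚ.+-identityˡ (sumℤ ys))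
  sumℤ-++ (x ∷ xs) ys rewrite sumℤ-++ xs ys = sym (ℤₚ.+-assoc x (sumℤ xs) (sumℤ ys))

  sumMap : (A → ℤ) → List A → ℤ
  sumMap f xs = sumℤ (map f xs)

  sumMap-cong : (f g : A → ℤ) (xs : List A) → (∀ x → x ∈ xs → f x ≡ g x) → sumMap f xs ≡ sumMap g xs
  sumMap-cong f g [] h = refl
  sumMap-cong f g (x ∷ xs) h = cong₂ ℤ._+_ (h x (here refl)) (sumMap-cong f g xs (λ y m → h y (there m)))

  sumMap-++ : (f : A → ℤ) (xs ys : List A) → sumMap f (xs ++ ys) ≡ sumMap f xs ℤ.+ sumMap f ys
  sumMap-++ f xs ys rewrite Listₚ.map-++ f xs ys = sumℤ-++ (map f xs) (map f ys)

  sumMap-map : (f : B → ℤ) (g : A → B) (xs : List A) → sumMap f (map g xs) ≡ sumMap (λ x → f (g x)) xs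
  sumMap-map f g xs = cong sumℤ (sym (Listₚ.map-∘ xs))

  sumMap-+ : (f g : A → ℤ) (xs : List A) → sumMap (λ x → f x ℤ.+ g x) xs ≡ sumMap f xs ℤ.+ sumMap g xs
  sumMap-+ f g [] = refl
  sumMap-+ f g (x ∷ xs) rewrite sumMap-+ f g xs = ℤ+.interchange (f x) (g x) (sumMap f xs) (sumMap g xs)

  sumMap-*ʳ : (f : A → ℤ) (c : ℤ) (xs : List A) → sumMap (λ x → f x ℤ.* c) xs ≡ sumMap f xs ℤ.* c
  sumMap-*ʳ f c [] = sym (ℤₚ.*-zeroˡ c)
  sumMap-*ʳ f c (x ∷ xs) rewrite sumMap-*ʳ f c xs = sym (ℤₚ.*-distribʳ-+ c (f x) (sumMap f xs))

  sumMap-*ˡ : (f : A → ℤ) (c : ℤ) (xs : List A) → sumMap (λ x → c ℤ.* f x) xs ≡ c ℤ.* sumMap f xs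
  sumMap-*ˡ f c [] = sym (ℤₚ.*-zeroʳ c)
  sumMap-*ˡ f c (x ∷ xs) rewrite sumMap-*ˡ f c xs = sym (ℤₚ.*-distribˡ-+ c (f x) (sumMap f xs))

  sumMap-zero : (f : A → ℤ) (xs : List A) → (∀ x → x ∈ xs → f x ≡ ℤ.0ℤ) → sumMap f xs ≡ ℤ.0ℤ
  sumMap-zero f [] h = refl
  sumMap-zero f (x ∷ xs) h rewrite h x (here refl) | sumMap-zero f xs (λ y m → h y (there m)) = refl

  Edge : Set
  Edge = ℕ × ℕ

  -- Connected components

  -- Defs' closure step, components, elementarity test and β, with the vertex set upTo n replaced by an
  -- arbitrary list V and the number of closure steps made explicit; weight V S is the summand of qG.
  closureStep : List ℕ → List Edge → List ℕ → List ℕ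
  closureStep V S C = filterᵇ (λ w → any (λ u → (u ≡ᵇ w) ∨ adj S u w) C) V

  componentAfter : ℕ → List ℕ → List Edge → ℕ → List ℕ
  componentAfter k V S v = iter k (closureStep V S) [ v ]

  isRepAfter : ℕ → List ℕ → List Edge → ℕ → Bool
  isRepAfter k V S v = all (v ≤ᵇ_) (componentAfter k V S v)

  repsAfter : ℕ → List ℕ → List Edge → List ℕ
  repsAfter k V S = filterᵇ (isRepAfter k V S) V

  isEdgeCompAfter : ℕ → List ℕ → List Edge → ℕ → Bool
  isEdgeCompAfter k V S v =
    (length (componentAfter k V S v) ≡ᵇ 2) ∧ (length (compEdges S (componentAfter k V S v)) ≡ᵇ 1)

  isCycleCompAfter : ℕ → List ℕ → List Edge → ℕ → Bool
  isCycleCompAfter k V S v =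
    (3 ≤ᵇ length (componentAfter k V S v)) ∧ all (λ w → deg S w ≡ᵇ 2) (componentAfter k V S v)

  isElementaryAfter : ℕ → List ℕ → List Edge → Bool
  isElementaryAfter k V S = all (λ v → isEdgeCompAfter k V S v ∨ isCycleCompAfter k V S v) (repsAfter k V S)

  βAfter : ℕ → List ℕ → List Edge → ℤ
  βAfter k V S = (ℤ.- ℤ.1ℤ) ^ count (isEdgeCompAfter k V S) (repsAfter k V S)
           ℤ.* (ℤ.- (+ 2)) ^ count (isCycleCompAfter k V S) (repsAfter k V S)

  weightAfter : ℕ → List ℕ → List Edge → ℤ
  weightAfter k V S = if isElementaryAfter k V S then βAfter k V S else ℤ.0ℤ

  weight : List ℕ → List Edge → ℤ
  weight V S = weightAfter (length V) V S

  qOn : List ℕ → List Edge → ℤ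
  qOn V E = sumMap (weight V) (subsets E)

  qG≡qOn : ∀ n E → qG (mkGraph n E) ≡ qOn (upTo n) E
  qG≡qOn n E = cong (λ k → sumMap (weightAfter k (upTo n)) (subsets E)) (sym (Listₚ.length-upTo n))

  adj-sym : ∀ S u w → adj S u w ≡ adj S w u
  adj-sym S u w = any-cong _ _ S λ e _ →
    Boolₚ.∨-comm ((proj₁ e ≡ᵇ u) ∧ (proj₂ e ≡ᵇ w)) ((proj₁ e ≡ᵇ w) ∧ (proj₂ e ≡ᵇ u))

  adj-↭ : ∀ {S S′} u w → S ↭ S′ → adj S u w ≡ adj S′ u w
  adj-↭ u w = any-↭ _

  ∈⇒adj : ∀ {S a b} → (a , b) ∈ S → adj S a b ≡ true
  ∈⇒adj {S} {a} {b} m = any⁺ _ m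
    (subst (λ t → (t ∨ ((a ≡ᵇ b) ∧ (b ≡ᵇ a))) ≡ true) (sym (cong₂ _∧_ (≡ᵇ-refl a) (≡ᵇ-refl b))) refl)

  adj⇒∈ : ∀ S u w → adj S u w ≡ true →
    ∃[ e ] (e ∈ S × ((proj₁ e ≡ u × proj₂ e ≡ w) ⊎ (proj₁ e ≡ w × proj₂ e ≡ u)))
  adj⇒∈ S u w h with any⁻ _ S h
  ... | e , m , t with ∨-true⁻ {(proj₁ e ≡ᵇ u) ∧ (proj₂ e ≡ᵇ w)} t
  ...   | inj₁ a = let (x , y) = ∧-true⁻ a in e , m , inj₁ (≡ᵇ⇒≡ x , ≡ᵇ⇒≡ y)
  ...   | inj₂ a = let (x , y) = ∧-true⁻ a in e , m , inj₂ (≡ᵇ⇒≡ x , ≡ᵇ⇒≡ y)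

  EdgesIn : List ℕ → List Edge → Set
  EdgesIn V S = ∀ {e} → e ∈ S → mem (proj₁ e) V ≡ true × mem (proj₂ e) V ≡ true

  EdgesIn-⊆ : ∀ {V E S} → EdgesIn V E → (∀ {e} → e ∈ S → e ∈ E) → EdgesIn V S
  EdgesIn-⊆ within sub m = within (sub m)

  adj-EdgesIn : ∀ {V S u w} → EdgesIn V S → adj S u w ≡ true → mem w V ≡ true
  adj-EdgesIn {S = S} {u} {w} within h with adj⇒∈ S u w h
  ... | e , m , inj₁ (_ , refl) = proj₂ (within m)
  ... | e , m , inj₂ (refl , _) = proj₁ (within m)

  data Reach (S : List Edge) (v : ℕ) : ℕ → Set where
    start : Reach S v v
    extend : ∀ {u w} → Reach S v u → adj S u w ≡ true → Reach S v w

  reach-trans : ∀ {S a b c} → Reach S a b → Reach S b c → Reach S a c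
  reach-trans p start = p
  reach-trans p (extend q x) = extend (reach-trans p q) x

  reach-sym : ∀ {S a b} → Reach S a b → Reach S b a
  reach-sym start = start
  reach-sym {S} (extend {u} {w} p h) = reach-trans (extend start (trans (adj-sym S w u) h)) (reach-sym p)

  iter-suc : ∀ j (f : List ℕ → List ℕ) C → iter (suc j) f C ≡ f (iter j f C)
  iter-suc zero f C = refl
  iter-suc (suc j) f C = iter-suc j f (f C)

  any-resp-mem : ∀ (g : ℕ → Bool) C D → (∀ z → mem z C ≡ mem z D) → any g C ≡ any g D
  any-resp-mem g C D h = ⇔⇒≡
    (λ e → let (x , m , gx) = any⁻ g C e in any⁺ g (mem⇒∈ D (trans (sym (h x)) (∈⇒mem m))) gx)
    (λ e → let (x , m , gx) = any⁻ g D e in any⁺ g (mem⇒∈ C (trans (h x) (∈⇒mem m))) gx)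

  closureStep-cong : ∀ V S C D → (∀ z → mem z C ≡ mem z D) → closureStep V S C ≡ closureStep V S D
  closureStep-cong V S C D h = filter-cong _ _ V (λ w _ → any-resp-mem _ C D h)

  mem-closureStep : ∀ V S C z → mem z (closureStep V S C) ≡ (any (λ u → (u ≡ᵇ z) ∨ adj S u z) C ∧ mem z V)
  mem-closureStep V S C z = mem-filter _ z V

  ClosureInv : List ℕ → List Edge → ℕ → List ℕ → Set
  ClosureInv V S v C = (mem v C ≡ true) × (∀ z → mem z C ≡ true → mem z V ≡ true × Reach S v z)

  module Closure (V : List ℕ) (S : List Edge) (v : ℕ) (v∈V : mem v V ≡ true) (within : EdgesIn V S) where

    stage : ℕ → List ℕ
    stage j = iter j (closureStep V S) [ v ]

    inv-start : ClosureInv V S v [ v ]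
    inv-start = cong (_∨ false) (≡ᵇ-refl v) ,
                λ z e → subst (λ y → mem y V ≡ true × Reach S v y) (sym (mem-single {z} {v} e)) (v∈V , start)

    grows : ∀ C → ClosureInv V S v C → ∀ z → mem z C ≡ true → mem z (closureStep V S C) ≡ true
    grows C (_ , sound) z e rewrite mem-closureStep V S C z | proj₁ (sound z e) =
      cong (_∧ true) (any⁺ (λ u → (u ≡ᵇ z) ∨ adj S u z) (mem⇒∈ C e) (cong (_∨ adj S z z) (≡ᵇ-refl z)))

    inv-step : ∀ C → ClosureInv V S v C → ClosureInv V S v (closureStep V S C)
    inv-step C inv@(v∈C , sound) = grows C inv v v∈C , λ z e →
      let (a , z∈V) = ∧-true⁻ (trans (sym (mem-closureStep V S C z)) e)
          (u , m , t) = any⁻ _ C a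
      in z∈V , reach-step (∨-true⁻ {u ≡ᵇ z} t) (proj₂ (sound u (∈⇒mem m)))
      where
      reach-step : ∀ {u z} → ((u ≡ᵇ z) ≡ true ⊎ adj S u z ≡ true) → Reach S v u → Reach S v z
      reach-step (inj₁ u≡z) r = subst (Reach S v) (≡ᵇ⇒≡ u≡z) r
      reach-step (inj₂ u~z) r = extend r u~z

    stage-inv : ∀ j → ClosureInv V S v (stage j)
    stage-inv zero = inv-start
    stage-inv (suc j) rewrite iter-suc j (closureStep V S) [ v ] = inv-step (stage j) (stage-inv j)

    isClosed : List ℕ → Bool
    isClosed D = all (λ z → not (mem z (closureStep V S D)) ∨ mem z D) V

    closed⇒fixed : ∀ D → ClosureInv V S v D → isClosed D ≡ true → ∀ z → mem z (closureStep V S D) ≡ mem z D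
    closed⇒fixed D inv@(_ , sound) closed z with mem z V in z∈V
    ... | true = ⇔⇒≡
      (modus-ponens (all⁻ (λ z → not (mem z (closureStep V S D)) ∨ mem z D) closed (mem⇒∈ {z} V z∈V)))
      (grows D inv z)
      where modus-ponens : ∀ {a b} → (not a ∨ b) ≡ true → a ≡ true → b ≡ true
            modus-ponens {true} h refl = h
    ... | false = trans (trans (mem-closureStep V S D z) (trans (cong (_ ∧_) z∈V) (Boolₚ.∧-zeroʳ _)))
                     (sym (outside (mem z D) refl))
      where outside : ∀ b → mem z D ≡ b → b ≡ false
            outside true e = contradiction (trans (sym (proj₁ (sound z e))) z∈V) λ ()
            outside false e = refl

    closed-step : ∀ D → ClosureInv V S v D → isClosed D ≡ true → isClosed (closureStep V S D) ≡ true
    closed-step D inv closed rewrite closureStep-cong V S (closureStep V S D) D (closed⇒fixed D inv closed) =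
      all⁺ _ V (λ z _ → excluded-middle (mem z (closureStep V S D)))
      where excluded-middle : ∀ b → (not b ∨ b) ≡ true
            excluded-middle true = refl
            excluded-middle false = refl

    size : List ℕ → ℕ
    size D = count (λ z → mem z D) V

    -- Until the closure is closed, every step adds a vertex of V, so it is closed after |V| steps.
    progress : ∀ j → isClosed (stage j) ≡ true ⊎ suc j ≤ size (stage j)
    progress zero = inj₂ (count-pos (λ z → mem z [ v ]) {v} V (mem⇒∈ V v∈V) (proj₁ inv-start))
    progress (suc j) rewrite iter-suc j (closureStep V S) [ v ] with progress j
    ... | inj₁ closed = inj₁ (closed-step (stage j) (stage-inv j) closed)
    ... | inj₂ bound with isClosed (stage j) in eq
    ...   | true = inj₁ (closed-step (stage j) (stage-inv j) eq)
    ...   | false with all-false⁻ _ V eq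
    ...     | z , z∈V , new = inj₂ (ℕₚ.≤-trans (s≤s bound)
                   (count-< _ _ V (λ x _ e → grows (stage j) (stage-inv j) x e) z∈V (old new) (reached new)))
      where old : ∀ {a b} → (not a ∨ b) ≡ false → b ≡ false
            old {true} {false} h = refl
            reached : ∀ {a b} → (not a ∨ b) ≡ false → a ≡ true
            reached {true} {false} h = refl

    closed-final : isClosed (stage (length V)) ≡ true
    closed-final with progress (length V)
    ... | inj₁ closed = closed
    ... | inj₂ bound = contradiction (ℕₚ.≤-trans bound (count-≤-length _ V)) (ℕₚ.<-irrefl refl)

    complete : ∀ {w} → Reach S v w → mem w (stage (length V)) ≡ true
    complete start = proj₁ (stage-inv (length V))
    complete {w} (extend {u} r h) = trans (sym (closed⇒fixed D (stage-inv (length V)) closed-final w)) w∈step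
      where
      D = stage (length V)
      w∈step : mem w (closureStep V S D) ≡ true
      w∈step = trans (mem-closureStep V S D w)
        (trans (cong (_∧ mem w V) (any⁺ (λ x → (x ≡ᵇ w) ∨ adj S x w) (mem⇒∈ D (complete r))
                                        (trans (cong ((u ≡ᵇ w) ∨_) h) (Boolₚ.∨-zeroʳ (u ≡ᵇ w)))))
               (adj-EdgesIn {V} {S} {u} {w} within h))

  component : List ℕ → List Edge → ℕ → List ℕ
  component V S v = componentAfter (length V) V S v

  connected : List ℕ → List Edge → ℕ → ℕ → Bool
  connected V S v w = mem w (component V S v)

  connected-sound : ∀ V S v w → mem v V ≡ true → EdgesIn V S → connected V S v w ≡ true → mem w V ≡ true × Reach S v w
  connected-sound V S v w v∈V within e = proj₂ (Closure.stage-inv V S v v∈V within (length V)) w e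

  connected-complete : ∀ V S v w → mem v V ≡ true → EdgesIn V S → Reach S v w → connected V S v w ≡ true
  connected-complete V S v w v∈V within = Closure.complete V S v v∈V within

  -- Invariance of the weight and its behaviour on disjoint unions

  record Classifier : Set where
    constructor classifier
    field
      represents formsEdge formsCycle : ℕ → Bool

  open Classifier

  _≗_on_ : Classifier → Classifier → List ℕ → Set
  c ≗ c′ on V = ∀ v → v ∈ V →
    represents c v ≡ represents c′ v × formsEdge c v ≡ formsEdge c′ v × formsCycle c v ≡ formsCycle c′ v

  accepts : Classifier → ℕ → Bool
  accepts c v = not (represents c v) ∨ (formsEdge c v ∨ formsCycle c v)

  weightBy : List ℕ → Classifier → ℤ
  weightBy V c = if all (accepts c) V
    then (ℤ.- ℤ.1ℤ) ^ count (λ v → represents c v ∧ formsEdge c v) V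
         ℤ.* (ℤ.- (+ 2)) ^ count (λ v → represents c v ∧ formsCycle c v) V
    else ℤ.0ℤ

  weightBy-cong : ∀ V c c′ → c ≗ c′ on V → weightBy V c ≡ weightBy V c′
  weightBy-cong V c c′ h
    rewrite all-cong (accepts c) (accepts c′) V
              (λ v m → let (r , e , y) = h v m in cong₂ (λ x y → not x ∨ y) r (cong₂ _∨_ e y))
          | count-cong (λ v → represents c v ∧ formsEdge c v) (λ v → represents c′ v ∧ formsEdge c′ v) V
              (λ v m → let (r , e , _) = h v m in cong₂ _∧_ r e)
          | count-cong (λ v → represents c v ∧ formsCycle c v) (λ v → represents c′ v ∧ formsCycle c′ v) V
              (λ v m → let (r , _ , y) = h v m in cong₂ _∧_ r y) = refl

  weightBy-↭ : ∀ {V V′} c → V ↭ V′ → weightBy V c ≡ weightBy V′ c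
  weightBy-↭ c r rewrite all-↭ (accepts c) r
    | count-↭ (λ v → represents c v ∧ formsEdge c v) r | count-↭ (λ v → represents c v ∧ formsCycle c v) r = refl

  if-∧-* : ∀ (a b : Bool) (x y : ℤ) →
    (if a ∧ b then x ℤ.* y else ℤ.0ℤ) ≡ (if a then x else ℤ.0ℤ) ℤ.* (if b then y else ℤ.0ℤ)
  if-∧-* true true x y = refl
  if-∧-* true false x y = sym (ℤₚ.*-zeroʳ x)
  if-∧-* false b x y = refl

  weightBy-++ : ∀ V₁ V₂ c → weightBy (V₁ ++ V₂) c ≡ weightBy V₁ c ℤ.* weightBy V₂ c
  weightBy-++ V₁ V₂ c
    rewrite all-++ (accepts c) V₁ V₂
          | count-++ (λ v → represents c v ∧ formsEdge c v) V₁ V₂ | count-++ (λ v → represents c v ∧ formsCycle c v) V₁ V₂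
          | ℤₚ.^-distribˡ-+-* (ℤ.- ℤ.1ℤ) (count (λ v → represents c v ∧ formsEdge c v) V₁)
                                         (count (λ v → represents c v ∧ formsEdge c v) V₂)
          | ℤₚ.^-distribˡ-+-* (ℤ.- (+ 2)) (count (λ v → represents c v ∧ formsCycle c v) V₁)
                                          (count (λ v → represents c v ∧ formsCycle c v) V₂)
    = trans (cong (λ z → if all (accepts c) V₁ ∧ all (accepts c) V₂ then z else ℤ.0ℤ)
                  (ℤ*.interchange (sign V₁) (sign V₂) (power V₁) (power V₂)))
            (if-∧-* (all (accepts c) V₁) (all (accepts c) V₂) (sign V₁ ℤ.* power V₁) (sign V₂ ℤ.* power V₂))
    where
    import Algebra.Properties.CommutativeSemigroup ℤₚ.*-commutativeSemigroup as ℤ*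
    sign power : List ℕ → ℤ
    sign V = (ℤ.- ℤ.1ℤ) ^ count (λ v → represents c v ∧ formsEdge c v) V
    power V = (ℤ.- (+ 2)) ^ count (λ v → represents c v ∧ formsCycle c v) V

  relabelClassifier : (ℕ → ℕ) → Classifier → Classifier
  relabelClassifier σ c = classifier (represents c ∘ σ) (formsEdge c ∘ σ) (formsCycle c ∘ σ)

  weightBy-map : ∀ (σ : ℕ → ℕ) V c → weightBy (map σ V) c ≡ weightBy V (relabelClassifier σ c)
  weightBy-map σ V c rewrite all-map (accepts c) σ V
    | count-map (λ v → represents c v ∧ formsEdge c v) σ V | count-map (λ v → represents c v ∧ formsCycle c v) σ V = refl

  weightBy-reject : ∀ V c {ρ} → ρ ∈ V → represents c ρ ≡ true → formsEdge c ρ ≡ false → formsCycle c ρ ≡ false →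
    weightBy V c ≡ ℤ.0ℤ
  weightBy-reject V c m r e y rewrite all-false⁺ (accepts c) m (subst (λ z → (not (represents c _) ∨ z) ≡ false)
    (sym (cong₂ _∨_ e y)) (cong (λ z → not z ∨ false) r)) = refl

  -- R v w is read as "w lies in the component of v".
  isRepVia : List ℕ → (ℕ → ℕ → Bool) → ℕ → Bool
  isRepVia V R v = all (λ w → not (R v w) ∨ (v ≤ᵇ w)) V

  isEdgeCompVia : List ℕ → List Edge → (ℕ → ℕ → Bool) → ℕ → Bool
  isEdgeCompVia V S R v = (count (R v) V ≡ᵇ 2) ∧ (count (λ e → R v (proj₁ e)) S ≡ᵇ 1)

  isCycleCompVia : List ℕ → List Edge → (ℕ → ℕ → Bool) → ℕ → Bool
  isCycleCompVia V S R v = (3 ≤ᵇ count (R v) V) ∧ all (λ w → not (R v w) ∨ (deg S w ≡ᵇ 2)) V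

  classifyVia : List ℕ → List Edge → (ℕ → ℕ → Bool) → Classifier
  classifyVia V S R = classifier (isRepVia V R) (isEdgeCompVia V S R) (isCycleCompVia V S R)

  weightVia : List ℕ → List Edge → (ℕ → ℕ → Bool) → ℤ
  weightVia V S R = weightBy V (classifyVia V S R)

  component≡filter : ∀ V S v → mem v V ≡ true → component V S v ≡ filterᵇ (connected V S v) V
  component≡filter (y ∷ ys) S v v∈V =
    trans last-step (filter-cong P (connected V S v) V (λ w m → sym (trans (cong (mem w) last-step)
      (trans (mem-filter P w V) (trans (cong (P w ∧_) (∈⇒mem m)) (Boolₚ.∧-identityʳ (P w)))))))
    where
    V = y ∷ ys
    P : ℕ → Bool
    P w = any (λ u → (u ≡ᵇ w) ∨ adj S u w) (iter (length ys) (closureStep V S) [ v ])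
    last-step : component V S v ≡ filterᵇ P V
    last-step = iter-suc (length ys) (closureStep V S) [ v ]

  weight≡weightVia : ∀ V S → weight V S ≡ weightVia V S (connected V S)
  weight≡weightVia V S = cong₂ (λ b z → if b then z else ℤ.0ℤ)
    (trans (all-filter (λ v → isEdgeCompAfter k V S v ∨ isCycleCompAfter k V S v) (isRepAfter k V S) V)
           (all-cong _ _ V (λ v m → let (r , e , y) = pointwise v m in cong₂ (λ x y → not x ∨ y) r (cong₂ _∨_ e y))))
    (cong₂ (λ x y → (ℤ.- ℤ.1ℤ) ^ x ℤ.* (ℤ.- (+ 2)) ^ y)
       (trans (count-filter (isEdgeCompAfter k V S) (isRepAfter k V S) V)
          (count-cong _ _ V (λ v m → let (r , e , _) = pointwise v m in cong₂ _∧_ r e)))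
       (trans (count-filter (isCycleCompAfter k V S) (isRepAfter k V S) V)
          (count-cong _ _ V (λ v m → let (r , _ , y) = pointwise v m in cong₂ _∧_ r y))))
    where
    k = length V
    R = connected V S
    pointwise : classifier (isRepAfter k V S) (isEdgeCompAfter k V S) (isCycleCompAfter k V S) ≗ classifyVia V S R on V
    pointwise v m = let cf = component≡filter V S v (∈⇒mem m) in
      trans (cong (all (v ≤ᵇ_)) cf) (all-filter (v ≤ᵇ_) (R v) V) ,
      cong (λ n → (n ≡ᵇ 2) ∧ (count (λ e → R v (proj₁ e)) S ≡ᵇ 1)) (cong length cf) ,
      cong₂ (λ n b → (3 ≤ᵇ n) ∧ b) (cong length cf)
        (trans (cong (all (λ w → deg S w ≡ᵇ 2)) cf) (all-filter (λ w → deg S w ≡ᵇ 2) (R v) V))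

  weightVia-cong : ∀ V S R R′ → (∀ v → v ∈ V → ∀ w → R v w ≡ R′ v w) → weightVia V S R ≡ weightVia V S R′
  weightVia-cong V S R R′ h = weightBy-cong V (classifyVia V S R) (classifyVia V S R′) λ v m →
    all-cong _ _ V (λ w _ → cong (λ x → not x ∨ (v ≤ᵇ w)) (h v m w)) ,
    cong₂ (λ a b → (a ≡ᵇ 2) ∧ (b ≡ᵇ 1)) (count-cong _ _ V (λ w _ → h v m w)) (count-cong _ _ S (λ e _ → h v m (proj₁ e))) ,
    cong₂ (λ a b → (3 ≤ᵇ a) ∧ b) (count-cong _ _ V (λ w _ → h v m w))
      (all-cong _ _ V (λ w _ → cong (λ x → not x ∨ (deg S w ≡ᵇ 2)) (h v m w)))

  weightVia-↭ᵛ : ∀ {V V′} S R → V ↭ V′ → weightVia V S R ≡ weightVia V′ S R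
  weightVia-↭ᵛ {V} {V′} S R r = trans (weightBy-cong V (classifyVia V S R) (classifyVia V′ S R) λ v _ →
      all-↭ _ r , cong (λ a → (a ≡ᵇ 2) ∧ _) (count-↭ (R v) r) ,
      cong₂ (λ a b → (3 ≤ᵇ a) ∧ b) (count-↭ (R v) r) (all-↭ _ r))
    (weightBy-↭ (classifyVia V′ S R) r)

  weightVia-↭ᵉ : ∀ V {S S′} R → S ↭ S′ → weightVia V S R ≡ weightVia V S′ R
  weightVia-↭ᵉ V {S} {S′} R r = weightBy-cong V (classifyVia V S R) (classifyVia V S′ R) λ v _ →
    refl , cong (λ a → _ ∧ (a ≡ᵇ 1)) (count-↭ _ r) ,
    cong (_ ∧_) (all-cong _ _ V (λ w _ → cong (λ d → not (R v w) ∨ (d ≡ᵇ 2)) (count-↭ (incident w) r)))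

  iter-cong : ∀ k (f g : List ℕ → List ℕ) C → (∀ D → f D ≡ g D) → iter k f C ≡ iter k g C
  iter-cong zero f g C h = refl
  iter-cong (suc k) f g C h rewrite h C = iter-cong k f g (g C) h

  component-↭ᵉ : ∀ V {S S′} v → S ↭ S′ → component V S v ≡ component V S′ v
  component-↭ᵉ V {S} {S′} v r = iter-cong (length V) (closureStep V S) (closureStep V S′) [ v ]
    (λ D → filter-cong _ _ V (λ w _ → any-cong _ _ D (λ u _ → cong ((u ≡ᵇ w) ∨_) (adj-↭ u w r))))

  weight-↭ᵉ : ∀ V {S S′} → S ↭ S′ → weight V S ≡ weight V S′
  weight-↭ᵉ V {S} {S′} r = begin
    weight V S                           ≡⟨ weight≡weightVia V S ⟩
    weightVia V S (connected V S)        ≡⟨ weightVia-↭ᵉ V (connected V S) r ⟩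
    weightVia V S′ (connected V S)       ≡⟨ weightVia-cong V S′ _ _ (λ v _ w → cong (mem w) (component-↭ᵉ V v r)) ⟩
    weightVia V S′ (connected V S′)      ≡⟨ weight≡weightVia V S′ ⟨
    weight V S′                          ∎
    where open ≡-Reasoning

  EdgesIn-↭ : ∀ {V V′ S} → V ↭ V′ → EdgesIn V S → EdgesIn V′ S
  EdgesIn-↭ r within {e} m =
    let (a , b) = within m in trans (sym (mem-↭ {proj₁ e} r)) a , trans (sym (mem-↭ {proj₂ e} r)) b

  weight-↭ᵛ : ∀ {V V′} S → EdgesIn V S → V ↭ V′ → weight V S ≡ weight V′ S
  weight-↭ᵛ {V} {V′} S within r = begin
    weight V S                           ≡⟨ weight≡weightVia V S ⟩
    weightVia V S (connected V S)        ≡⟨ weightVia-↭ᵛ S (connected V S) r ⟩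
    weightVia V′ S (connected V S)       ≡⟨ weightVia-cong V′ S _ _ same-components ⟩
    weightVia V′ S (connected V′ S)      ≡⟨ weight≡weightVia V′ S ⟨
    weight V′ S                          ∎
    where
    open ≡-Reasoning
    within′ = EdgesIn-↭ r within
    same-components : ∀ v → v ∈ V′ → ∀ w → connected V S v w ≡ connected V′ S v w
    same-components v m w = let v∈V′ = ∈⇒mem m ; v∈V = trans (mem-↭ {v} r) v∈V′ in ⇔⇒≡
      (λ e → connected-complete V′ S v w v∈V′ within′ (proj₂ (connected-sound V S v w v∈V within e)))
      (λ e → connected-complete V S v w v∈V within (proj₂ (connected-sound V′ S v w v∈V′ within′ e)))

  Disjoint : List ℕ → List ℕ → Set
  Disjoint V₁ V₂ = ∀ z → mem z V₁ ≡ true → mem z V₂ ≡ false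

  disjoint-sym : ∀ {V₁ V₂} → Disjoint V₁ V₂ → Disjoint V₂ V₁
  disjoint-sym {V₁} disj z e with mem z V₁ in eq
  ... | true = contradiction (trans (sym e) (disj z eq)) λ ()
  ... | false = refl

  module DisjointPiece (V V₁ V₂ : List ℕ) (S S₁ S₂ : List Edge) (rV : V ↭ V₁ ++ V₂) (rS : S ↭ S₁ ++ S₂)
     (within₁ : EdgesIn V₁ S₁) (within₂ : EdgesIn V₂ S₂) (disj : Disjoint V₁ V₂) where

    R = connected V S
    R₁ = connected V₁ S₁

    ∈V₁⇒∈V : ∀ z → mem z V₁ ≡ true → mem z V ≡ true
    ∈V₁⇒∈V z e = trans (mem-↭ {z} rV) (mem-++ˡ z V₁ V₂ e)

    ∈V₂⇒∈V : ∀ z → mem z V₂ ≡ true → mem z V ≡ true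
    ∈V₂⇒∈V z e = trans (mem-↭ {z} rV) (mem-++ʳ z V₁ V₂ e)

    within : EdgesIn V S
    within {e} m with ∈-++⁻ S₁ (↭ₚ.∈-resp-↭ rS m)
    ... | inj₁ m₁ = let (a , b) = within₁ m₁ in ∈V₁⇒∈V (proj₁ e) a , ∈V₁⇒∈V (proj₂ e) b
    ... | inj₂ m₂ = let (a , b) = within₂ m₂ in ∈V₂⇒∈V (proj₁ e) a , ∈V₂⇒∈V (proj₂ e) b

    adj-split : ∀ u w → adj S u w ≡ (adj S₁ u w ∨ adj S₂ u w)
    adj-split u w = trans (adj-↭ u w rS) (any-++ _ S₁ S₂)

    restrict : ∀ {v w} → mem v V₁ ≡ true → Reach S v w → mem w V₁ ≡ true × Reach S₁ v w
    restrict v∈V₁ start = v∈V₁ , start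
    restrict v∈V₁ (extend {u} {w} p h) with restrict v∈V₁ p
    ... | u∈V₁ , r₁ with ∨-true⁻ {adj S₁ u w} (trans (sym (adj-split u w)) h)
    ...   | inj₁ h₁ = adj-EdgesIn {V₁} {S₁} {u} {w} within₁ h₁ , extend r₁ h₁
    ...   | inj₂ h₂ = contradiction (trans (sym (adj-EdgesIn {V₂} {S₂} {w} {u} within₂ (trans (adj-sym S₂ w u) h₂)))
                                           (disj u u∈V₁)) λ ()

    lift : ∀ {v w} → Reach S₁ v w → Reach S v w
    lift start = start
    lift (extend {u} {w} p h) = extend (lift p) (trans (adj-split u w) (cong (_∨ adj S₂ u w) h))

    same-component : ∀ v w → mem v V₁ ≡ true → R v w ≡ R₁ v w
    same-component v w v∈V₁ = ⇔⇒≡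
      (λ e → connected-complete V₁ S₁ v w v∈V₁ within₁
               (proj₂ (restrict v∈V₁ (proj₂ (connected-sound V S v w (∈V₁⇒∈V v v∈V₁) within e)))))
      (λ e → connected-complete V S v w (∈V₁⇒∈V v v∈V₁) within
               (lift (proj₂ (connected-sound V₁ S₁ v w v∈V₁ within₁ e))))

    unrelated : ∀ v w → mem v V₁ ≡ true → mem w V₂ ≡ true → R v w ≡ false
    unrelated v w v∈V₁ w∈V₂ with R v w in eq
    ... | true = contradiction (trans (sym w∈V₂)
                   (disj w (proj₁ (connected-sound V₁ S₁ v w v∈V₁ within₁ (trans (sym (same-component v w v∈V₁)) eq))))) λ ()
    ... | false = refl

    component-size : ∀ v → mem v V₁ ≡ true → count (R v) V ≡ count (R₁ v) V₁
    component-size v v∈V₁ = trans (trans (count-↭ (R v) rV) (count-++ (R v) V₁ V₂))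
      (trans (cong₂ _+_ (count-cong _ _ V₁ (λ w _ → same-component v w v∈V₁))
                        (count-zero _ V₂ (λ w m → unrelated v w v∈V₁ (∈⇒mem m))))
             (ℕₚ.+-identityʳ _))

    component-edges : ∀ v → mem v V₁ ≡ true → count (λ e → R v (proj₁ e)) S ≡ count (λ e → R₁ v (proj₁ e)) S₁
    component-edges v v∈V₁ = trans (trans (count-↭ _ rS) (count-++ _ S₁ S₂))
      (trans (cong₂ _+_ (count-cong _ _ S₁ (λ e _ → same-component v (proj₁ e) v∈V₁))
                        (count-zero _ S₂ (λ e m → unrelated v (proj₁ e) v∈V₁ (proj₁ (within₂ m)))))
             (ℕₚ.+-identityʳ _))

    all-split : ∀ v (g : ℕ → Bool) → mem v V₁ ≡ true →
      all (λ w → not (R v w) ∨ g w) V ≡ all (λ w → not (R₁ v w) ∨ g w) V₁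
    all-split v g v∈V₁ = trans (trans (all-↭ _ rV) (all-++ _ V₁ V₂))
      (trans (cong₂ _∧_ (all-cong _ _ V₁ (λ w _ → cong (λ x → not x ∨ g w) (same-component v w v∈V₁)))
                        (all⁺ _ V₂ (λ w m → cong (λ x → not x ∨ g w) (unrelated v w v∈V₁ (∈⇒mem m)))))
             (Boolₚ.∧-identityʳ _))

    deg-piece : ∀ w → mem w V₁ ≡ true → deg S w ≡ deg S₁ w
    deg-piece w w∈V₁ = trans (trans (count-↭ (incident w) rS) (count-++ (incident w) S₁ S₂))
      (trans (cong (λ n → deg S₁ w + n) (count-zero (incident w) S₂ (λ e m → let (a , b) = within₂ m in
                cong₂ _∨_ (distinct (proj₁ e) a) (distinct (proj₂ e) b))))
             (ℕₚ.+-identityʳ _))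
      where distinct : ∀ x → mem x V₂ ≡ true → (x ≡ᵇ w) ≡ false
            distinct x x∈V₂ = ≢⇒≡ᵇ-false {x} {w} λ { refl → contradiction (trans (sym x∈V₂) (disj x w∈V₁)) λ () }

    classify-piece : classifyVia V S R ≗ classifyVia V₁ S₁ R₁ on V₁
    classify-piece v m = let v∈V₁ = ∈⇒mem m in
      all-split v (v ≤ᵇ_) v∈V₁ ,
      cong₂ (λ a b → (a ≡ᵇ 2) ∧ (b ≡ᵇ 1)) (component-size v v∈V₁) (component-edges v v∈V₁) ,
      cong₂ (λ a b → (3 ≤ᵇ a) ∧ b) (component-size v v∈V₁)
        (trans (all-split v (λ w → deg S w ≡ᵇ 2) v∈V₁)
               (all-cong _ _ V₁ (λ w m → cong (λ d → not (R₁ v w) ∨ (d ≡ᵇ 2)) (deg-piece w (∈⇒mem m)))))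

    weight-piece : weightBy V₁ (classifyVia V S R) ≡ weight V₁ S₁
    weight-piece = trans (weightBy-cong V₁ _ _ classify-piece) (sym (weight≡weightVia V₁ S₁))

  weight-disjoint : ∀ V V₁ V₂ S₁ S₂ → V ↭ V₁ ++ V₂ → EdgesIn V₁ S₁ → EdgesIn V₂ S₂ → Disjoint V₁ V₂ →
    weight V (S₁ ++ S₂) ≡ weight V₁ S₁ ℤ.* weight V₂ S₂
  weight-disjoint V V₁ V₂ S₁ S₂ rV within₁ within₂ disj = begin
    weight V S                                       ≡⟨ weight≡weightVia V S ⟩
    weightBy V c                                     ≡⟨ weightBy-↭ c rV ⟩
    weightBy (V₁ ++ V₂) c                            ≡⟨ weightBy-++ V₁ V₂ c ⟩
    weightBy V₁ c ℤ.* weightBy V₂ c                  ≡⟨ cong₂ ℤ._*_ Piece₁.weight-piece Piece₂.weight-piece ⟩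
    weight V₁ S₁ ℤ.* weight V₂ S₂                    ∎
    where
    open ≡-Reasoning
    S = S₁ ++ S₂
    c = classifyVia V S (connected V S)
    module Piece₁ = DisjointPiece V V₁ V₂ S S₁ S₂ rV ↭.refl within₁ within₂ disj
    module Piece₂ = DisjointPiece V V₂ V₁ S S₂ S₁ (↭-trans rV (↭ₚ.++-comm V₁ V₂)) (↭ₚ.++-comm S₁ S₂)
                      within₂ within₁ (disjoint-sym {V₁} {V₂} disj)

  mapEdge : (ℕ → ℕ) → Edge → Edge
  mapEdge σ e = (σ (proj₁ e) , σ (proj₂ e))

  StrictlyMonotoneOn : List ℕ → (ℕ → ℕ) → Set
  StrictlyMonotoneOn V σ = ∀ a b → mem a V ≡ true → mem b V ≡ true → a < b → σ a < σ b

  -- Only the order of the labels enters the definitions (through component representatives), so an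
  -- order-preserving relabelling does not change the weight.
  module Relabel (σ : ℕ → ℕ) (V : List ℕ) (S : List Edge) (within : EdgesIn V S) (mono : StrictlyMonotoneOn V σ) where

    V′ = map σ V
    S′ = map (mapEdge σ) S

    σ-injective : ∀ a b → mem a V ≡ true → mem b V ≡ true → σ a ≡ σ b → a ≡ b
    σ-injective a b a∈V b∈V e with ℕₚ.<-cmp a b
    ... | tri< lt _ _ = contradiction e (ℕₚ.<⇒≢ (mono a b a∈V b∈V lt))
    ... | tri≈ _ eq _ = eq
    ... | tri> _ _ gt = contradiction (sym e) (ℕₚ.<⇒≢ (mono b a b∈V a∈V gt))

    σ-≡ᵇ : ∀ a b → mem a V ≡ true → mem b V ≡ true → (σ a ≡ᵇ σ b) ≡ (a ≡ᵇ b)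
    σ-≡ᵇ a b a∈V b∈V = ⇔⇒≡
      (λ e → subst (λ y → (a ≡ᵇ y) ≡ true) (σ-injective a b a∈V b∈V (≡ᵇ⇒≡ {σ a} {σ b} e)) (≡ᵇ-refl a))
      (λ e → subst (λ y → (σ a ≡ᵇ σ y) ≡ true) (≡ᵇ⇒≡ {a} {b} e) (≡ᵇ-refl (σ a)))

    σ-≤ᵇ : ∀ a b → mem a V ≡ true → mem b V ≡ true → (σ a ≤ᵇ σ b) ≡ (a ≤ᵇ b)
    σ-≤ᵇ a b a∈V b∈V = ⇔⇒≡
      (λ e → ≤⇒≤ᵇ (ℕₚ.≮⇒≥ (λ lt → ℕₚ.<⇒≱ (mono b a b∈V a∈V lt) (≤ᵇ⇒≤ e))))
      (λ e → ≤⇒≤ᵇ (mono-≤ (ℕₚ.m≤n⇒m<n∨m≡n (≤ᵇ⇒≤ e))))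
      where mono-≤ : a < b ⊎ a ≡ b → σ a ≤ σ b
            mono-≤ (inj₁ lt) = ℕₚ.<⇒≤ (mono a b a∈V b∈V lt)
            mono-≤ (inj₂ refl) = ℕₚ.≤-refl

    σ-mem : ∀ a → mem a V ≡ true → mem (σ a) V′ ≡ true
    σ-mem a e = ∈⇒mem (∈-map⁺ σ (mem⇒∈ V e))

    within′ : EdgesIn V′ S′
    within′ m with ∈-map⁻ (mapEdge σ) m
    ... | e , e∈S , refl = let (a , b) = within e∈S in σ-mem (proj₁ e) a , σ-mem (proj₂ e) b

    adj-σ : ∀ a b → mem a V ≡ true → mem b V ≡ true → adj S′ (σ a) (σ b) ≡ adj S a b
    adj-σ a b a∈V b∈V = trans (any-map _ (mapEdge σ) S) (any-cong _ _ S (λ e m → let (x , y) = within m in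
       cong₂ _∨_ (cong₂ _∧_ (σ-≡ᵇ _ a x a∈V) (σ-≡ᵇ _ b y b∈V))
                 (cong₂ _∧_ (σ-≡ᵇ _ b x b∈V) (σ-≡ᵇ _ a y a∈V))))

    deg-σ : ∀ w → mem w V ≡ true → deg S′ (σ w) ≡ deg S w
    deg-σ w w∈V = trans (count-map (incident (σ w)) (mapEdge σ) S) (count-cong _ _ S (λ e m → let (x , y) = within m in
       cong₂ _∨_ (σ-≡ᵇ _ w x w∈V) (σ-≡ᵇ _ w y w∈V)))

    reach-σ : ∀ {v w} → mem v V ≡ true → Reach S v w → mem w V ≡ true × Reach S′ (σ v) (σ w)
    reach-σ v∈V start = v∈V , start
    reach-σ v∈V (extend {u} {w} p h) =
      let (u∈V , r) = reach-σ v∈V p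
          w∈V = adj-EdgesIn {V} {S} {u} {w} within h
      in w∈V , extend r (trans (adj-σ u w u∈V w∈V) h)

    reach-σ⁻ : ∀ {v z} → mem v V ≡ true → Reach S′ (σ v) z → ∃[ w ] (mem w V ≡ true × z ≡ σ w × Reach S v w)
    reach-σ⁻ {v} v∈V start = v , v∈V , refl , start
    reach-σ⁻ v∈V (extend {w = z} p h) with reach-σ⁻ v∈V p
    ... | w , w∈V , refl , r with adj⇒∈ S′ (σ w) z h
    ...   | _ , e′∈S′ , ends with ∈-map⁻ (mapEdge σ) e′∈S′
    ...     | e , e∈S , refl with ends | within e∈S
    ...       | inj₁ (p₁ , p₂) | (x , y) = proj₂ e , y , sym p₂ ,
                  extend r (subst (λ t → adj S t (proj₂ e) ≡ true) (σ-injective (proj₁ e) w x w∈V p₁) (∈⇒adj e∈S))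
    ...       | inj₂ (p₁ , p₂) | (x , y) = proj₁ e , x , sym p₁ , extend r (trans (adj-sym S w (proj₁ e))
                  (subst (λ t → adj S (proj₁ e) t ≡ true) (σ-injective (proj₂ e) w y w∈V p₂) (∈⇒adj e∈S)))

    R = connected V S
    R′ = connected V′ S′

    connected-σ : ∀ v w → mem v V ≡ true → mem w V ≡ true → R′ (σ v) (σ w) ≡ R v w
    connected-σ v w v∈V w∈V = ⇔⇒≡
      (λ e → let (w′ , w′∈V , eq , r) = reach-σ⁻ v∈V (proj₂ (connected-sound V′ S′ (σ v) (σ w) (σ-mem v v∈V) within′ e))
             in connected-complete V S v w v∈V within (subst (Reach S v) (sym (σ-injective w w′ w∈V w′∈V eq)) r))
      (λ e → connected-complete V′ S′ (σ v) (σ w) (σ-mem v v∈V) within′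
               (proj₂ (reach-σ v∈V (proj₂ (connected-sound V S v w v∈V within e)))))

    classify-σ : relabelClassifier σ (classifyVia V′ S′ R′) ≗ classifyVia V S R on V
    classify-σ v m =
      trans (all-map _ σ V) (all-cong _ _ V (λ w m′ → let w∈V = ∈⇒mem m′ in
          cong₂ (λ a b → not a ∨ b) (connected-σ v w v∈V w∈V) (σ-≤ᵇ v w v∈V w∈V))) ,
      cong₂ (λ a b → (a ≡ᵇ 2) ∧ (b ≡ᵇ 1)) size
          (trans (count-map _ (mapEdge σ) S) (count-cong _ _ S (λ e m′ → connected-σ v (proj₁ e) v∈V (proj₁ (within m′))))) ,
      cong₂ (λ a b → (3 ≤ᵇ a) ∧ b) size
          (trans (all-map _ σ V) (all-cong _ _ V (λ w m′ → let w∈V = ∈⇒mem m′ in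
             cong₂ (λ a d → not a ∨ (d ≡ᵇ 2)) (connected-σ v w v∈V w∈V) (deg-σ w w∈V))))
      where
      v∈V = ∈⇒mem m
      size = trans (count-map (R′ (σ v)) σ V) (count-cong _ _ V (λ w m′ → connected-σ v w v∈V (∈⇒mem m′)))

    weight-relabel : weight V′ S′ ≡ weight V S
    weight-relabel = begin
      weight V′ S′                                        ≡⟨ weight≡weightVia V′ S′ ⟩
      weightBy (map σ V) (classifyVia V′ S′ R′)           ≡⟨ weightBy-map σ V (classifyVia V′ S′ R′) ⟩
      weightBy V (relabelClassifier σ (classifyVia V′ S′ R′)) ≡⟨ weightBy-cong V _ _ classify-σ ⟩
      weightVia V S R                                     ≡⟨ weight≡weightVia V S ⟨
      weight V S                                          ∎
      where open ≡-Reasoning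

  reach-isolated : ∀ S v → deg S v ≡ 0 → ∀ {w} → Reach S v w → w ≡ v
  reach-isolated S v d start = refl
  reach-isolated S v d (extend {w = w} p h) with reach-isolated S v d p
  ... | refl with adj⇒∈ S v w h
  ...   | e , m , inj₁ (p₁ , _) = contradiction (count-pos (incident v) S m
            (cong (_∨ (proj₂ e ≡ᵇ v)) (trans (cong (_≡ᵇ v) p₁) (≡ᵇ-refl v)))) (ℕₚ.<-irrefl (sym d))
  ...   | e , m , inj₂ (_ , p₂) = contradiction (count-pos (incident v) S m
            (trans (cong ((proj₁ e ≡ᵇ v) ∨_) (trans (cong (_≡ᵇ v) p₂) (≡ᵇ-refl v))) (Boolₚ.∨-zeroʳ _))) (ℕₚ.<-irrefl (sym d))

  -- In both cases the component of v is neither a single edge nor a cycle.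
  data Defect (S : List Edge) (v : ℕ) : Set where
    isolated : deg S v ≡ 0 → Defect S v
    branching : deg S v ≢ 2 → ∀ {w} → Reach S v w → 2 ≤ deg S w → Defect S v

  module Defective (V : List ℕ) (S : List Edge) (v : ℕ) (within : EdgesIn V S) (v∈V : mem v V ≡ true) where

    R = connected V S
    C = filterᵇ (R v) V

    ρ : ℕ
    ρ = Extrema.min v C

    ∈C : ∀ {w} → Reach S v w → w ∈ C
    ∈C {w} r = ∈-filter⁺ (R v) V (mem⇒∈ V (proj₁ (connected-sound V S v w v∈V within e))) e
      where e = connected-complete V S v w v∈V within r

    ρ∈C : ρ ∈ C
    ρ∈C with Extrema.argmin-sel id v C
    ... | inj₁ ρ≡v = subst (_∈ C) (sym ρ≡v) (∈C start)
    ... | inj₂ ρ∈C = ρ∈C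

    ρ∈V : mem ρ V ≡ true
    ρ∈V = ∈⇒mem (proj₁ (∈-filter⁻ (R v) V ρ∈C))

    v⇝ρ : Reach S v ρ
    v⇝ρ = proj₂ (connected-sound V S v ρ v∈V within (proj₂ (∈-filter⁻ (R v) V ρ∈C)))

    related : ∀ {w} → Reach S v w → R ρ w ≡ true
    related r = connected-complete V S ρ _ ρ∈V within (reach-trans (reach-sym v⇝ρ) r)

    represents-ρ : isRepVia V R ρ ≡ true
    represents-ρ = all⁺ _ V (λ w _ → ⇒-not-∨ (λ e →
      ≤⇒≤ᵇ (All.lookup (Extrema.min≤xs v C) (∈C (reach-trans v⇝ρ (proj₂ (connected-sound V S ρ w ρ∈V within e)))))))

    not-cycle : deg S v ≢ 2 → isCycleCompVia V S R ρ ≡ false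
    not-cycle d≢2 = ∧-falseʳ (3 ≤ᵇ count (R ρ) V) (all-false⁺ _ (mem⇒∈ V v∈V)
       (cong₂ (λ a b → not a ∨ b) (related start) (≢⇒≡ᵇ-false d≢2)))

    not-edge-isolated : deg S v ≡ 0 → isEdgeCompVia V S R ρ ≡ false
    not-edge-isolated d≡0 = ∧-falseʳ (count (R ρ) V ≡ᵇ 2) (cong (_≡ᵇ 1) (count-zero _ S no-edge))
      where
      no-edge : ∀ e → e ∈ S → R ρ (proj₁ e) ≡ false
      no-edge e m with R ρ (proj₁ e) in eq
      ... | false = refl
      ... | true = contradiction (count-pos (incident v) S m
                     (cong (_∨ (proj₂ e ≡ᵇ v)) (trans (cong (_≡ᵇ v) e₁≡v) (≡ᵇ-refl v)))) (ℕₚ.<-irrefl (sym d≡0))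
        where e₁≡v = reach-isolated S v d≡0 (reach-trans v⇝ρ (proj₂ (connected-sound V S ρ (proj₁ e) ρ∈V within eq)))

    not-edge-branching : ∀ {w} → Reach S v w → 2 ≤ deg S w → isEdgeCompVia V S R ρ ≡ false
    not-edge-branching {w} v⇝w 2≤d = ∧-falseʳ (count (R ρ) V ≡ᵇ 2)
      (≢⇒≡ᵇ-false (λ e → ℕₚ.<-irrefl refl
        (ℕₚ.≤-trans 2≤d (ℕₚ.≤-trans (count-mono (incident w) _ S in-component) (ℕₚ.≤-reflexive e)))))
      where
      in-component : ∀ e → e ∈ S → incident w e ≡ true → R ρ (proj₁ e) ≡ true
      in-component e m ie with ∨-true⁻ {proj₁ e ≡ᵇ w} ie
      ... | inj₁ x = subst (λ y → R ρ y ≡ true) (sym (≡ᵇ⇒≡ {proj₁ e} {w} x)) (related v⇝w)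
      ... | inj₂ x = related (extend v⇝w (trans (adj-sym S w (proj₁ e))
                       (subst (λ y → adj S (proj₁ e) y ≡ true) (≡ᵇ⇒≡ {proj₂ e} {w} x) (∈⇒adj m))))

  weight-defect : ∀ V S v → EdgesIn V S → mem v V ≡ true → Defect S v → weight V S ≡ ℤ.0ℤ
  weight-defect V S v within v∈V defect = trans (weight≡weightVia V S)
    (weightBy-reject V (classifyVia V S R) (mem⇒∈ V ρ∈V) represents-ρ (not-edge defect) (not-cycle (≢2 defect)))
    where
    open Defective V S v within v∈V
    ≢2 : Defect S v → deg S v ≢ 2
    ≢2 (isolated d≡0) d≡2 = contradiction (trans (sym d≡0) d≡2) λ ()
    ≢2 (branching d≢2 _ _) = d≢2
    not-edge : Defect S v → isEdgeCompVia V S R ρ ≡ false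
    not-edge (isolated d≡0) = not-edge-isolated d≡0
    not-edge (branching _ v⇝w 2≤d) = not-edge-branching v⇝w 2≤d

  sumSubsets : (List A → ℤ) → List A → ℤ
  sumSubsets g xs = sumMap g (subsets xs)

  sumSubsets-∷ : (g : List A → ℤ) (x : A) (xs : List A) →
    sumSubsets g (x ∷ xs) ≡ sumSubsets g xs ℤ.+ sumSubsets (λ S → g (x ∷ S)) xs
  sumSubsets-∷ g x xs = trans (sumMap-++ g (subsets xs) (map (x ∷_) (subsets xs)))
    (cong (λ t → sumSubsets g xs ℤ.+ t) (sumMap-map g (x ∷_) (subsets xs)))

  ∈-subsets⇒⊆ : (xs : List A) {S : List A} → S ∈ subsets xs → ∀ {e} → e ∈ S → e ∈ xs
  ∈-subsets⇒⊆ [] (here refl) ()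
  ∈-subsets⇒⊆ (x ∷ xs) m e∈S with ∈-++⁻ (subsets xs) m
  ... | inj₁ m₁ = there (∈-subsets⇒⊆ xs m₁ e∈S)
  ... | inj₂ m₂ with ∈-map⁻ (x ∷_) m₂ | e∈S
  ...   | S′ , m′ , refl | here refl = here refl
  ...   | S′ , m′ , refl | there e∈S′ = there (∈-subsets⇒⊆ xs m′ e∈S′)

  sumSubsets-∷∷ : (g : List A → ℤ) (x y : A) (xs : List A) → sumSubsets g (x ∷ y ∷ xs) ≡
    (sumSubsets g xs ℤ.+ sumSubsets (λ S → g (y ∷ S)) xs) ℤ.+
    (sumSubsets (λ S → g (x ∷ S)) xs ℤ.+ sumSubsets (λ S → g (x ∷ y ∷ S)) xs)
  sumSubsets-∷∷ g x y xs =
    trans (sumSubsets-∷ g x (y ∷ xs)) (cong₂ ℤ._+_ (sumSubsets-∷ g y xs) (sumSubsets-∷ (λ S → g (x ∷ S)) y xs))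

  sumSubsets-↭ : (g : List A → ℤ) → (∀ {S S′} → S ↭ S′ → g S ≡ g S′) →
    ∀ {xs ys} → xs ↭ ys → sumSubsets g xs ≡ sumSubsets g ys
  sumSubsets-↭ g inv ↭.refl = refl
  sumSubsets-↭ g inv (↭.prep {xs = xs} {ys = ys} x r) = begin
    sumSubsets g (x ∷ xs)                                  ≡⟨ sumSubsets-∷ g x xs ⟩
    sumSubsets g xs ℤ.+ sumSubsets (λ S → g (x ∷ S)) xs    ≡⟨ cong₂ ℤ._+_ (sumSubsets-↭ g inv r)
                                                                 (sumSubsets-↭ (λ S → g (x ∷ S)) (inv ∘ ↭.prep x) r) ⟩
    sumSubsets g ys ℤ.+ sumSubsets (λ S → g (x ∷ S)) ys    ≡⟨ sumSubsets-∷ g x ys ⟨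
    sumSubsets g (x ∷ ys)                                  ∎
    where open ≡-Reasoning
  sumSubsets-↭ g inv (↭.swap {xs = xs} {ys = ys} x y r) = begin
    sumSubsets g (x ∷ y ∷ xs)              ≡⟨ sumSubsets-∷∷ g x y xs ⟩
    (Σ g xs ℤ.+ Σ gy xs) ℤ.+ (Σ gx xs ℤ.+ Σ gxy xs)
      ≡⟨ cong₂ ℤ._+_ (cong₂ ℤ._+_ (sumSubsets-↭ g inv r) (sumSubsets-↭ gy (inv ∘ ↭.prep y) r))
                     (cong₂ ℤ._+_ (sumSubsets-↭ gx (inv ∘ ↭.prep x) r)
                                  (trans (sumSubsets-↭ gxy (inv ∘ ↭.prep x ∘ ↭.prep y) r)
                                         (sumMap-cong _ _ (subsets ys) (λ S _ → inv (↭.swap x y ↭.refl))))) ⟩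
    (Σ g ys ℤ.+ Σ gy ys) ℤ.+ (Σ gx ys ℤ.+ Σ gyx ys)
      ≡⟨ ℤ+.interchange (Σ g ys) (Σ gy ys) (Σ gx ys) (Σ gyx ys) ⟩
    (Σ g ys ℤ.+ Σ gx ys) ℤ.+ (Σ gy ys ℤ.+ Σ gyx ys)   ≡⟨ sumSubsets-∷∷ g y x ys ⟨
    sumSubsets g (y ∷ x ∷ ys)              ∎
    where
    open ≡-Reasoning
    Σ = sumSubsets
    gx gy gxy gyx : List _ → ℤ
    gx S = g (x ∷ S)
    gy S = g (y ∷ S)
    gxy S = g (x ∷ y ∷ S)
    gyx S = g (y ∷ x ∷ S)
  sumSubsets-↭ g inv (↭.trans r s) = trans (sumSubsets-↭ g inv r) (sumSubsets-↭ g inv s)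

  sumSubsets-++ : (g : List A → ℤ) (xs ys : List A) →
    sumSubsets g (xs ++ ys) ≡ sumSubsets (λ P → sumSubsets (λ Q → g (P ++ Q)) ys) xs
  sumSubsets-++ g [] ys = sym (ℤₚ.+-identityʳ _)
  sumSubsets-++ g (x ∷ xs) ys = trans (sumSubsets-∷ g x (xs ++ ys))
    (trans (cong₂ ℤ._+_ (sumSubsets-++ g xs ys) (sumSubsets-++ (λ S → g (x ∷ S)) xs ys))
      (sym (sumSubsets-∷ (λ P → sumSubsets (λ Q → g (P ++ Q)) ys) x xs)))

  sumSubsets-map : (g : List B → ℤ) (f : A → B) (xs : List A) → sumSubsets g (map f xs) ≡ sumSubsets (λ S → g (map f S)) xs
  sumSubsets-map g f [] = refl
  sumSubsets-map g f (x ∷ xs) = trans (sumSubsets-∷ g (f x) (map f xs))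
    (trans (cong₂ ℤ._+_ (sumSubsets-map g f xs) (sumSubsets-map (λ S → g (f x ∷ S)) f xs))
      (sym (sumSubsets-∷ (λ S → g (map f S)) x xs)))

  sumSubsets-only-[] : (g : List A → ℤ) (xs : List A) →
    (∀ y → y ∈ xs → ∀ S → S ∈ subsets xs → g (y ∷ S) ≡ ℤ.0ℤ) → sumSubsets g xs ≡ g []
  sumSubsets-only-[] g [] h = ℤₚ.+-identityʳ _
  sumSubsets-only-[] g (x ∷ xs) h = trans (sumSubsets-∷ g x xs)
    (trans (cong₂ ℤ._+_ (sumSubsets-only-[] g xs (λ y m S S∈ → h y (there m) S (∈-++⁺ˡ S∈)))
                        (sumMap-zero _ (subsets xs) (λ S S∈ → h x (here refl) S (∈-++⁺ˡ S∈))))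
       (ℤₚ.+-identityʳ _))

  qOn-↭ᵉ : ∀ V {E E′} → E ↭ E′ → qOn V E ≡ qOn V E′
  qOn-↭ᵉ V = sumSubsets-↭ (weight V) (weight-↭ᵉ V)

  qOn-↭ᵛ : ∀ {V V′} E → EdgesIn V E → V ↭ V′ → qOn V E ≡ qOn V′ E
  qOn-↭ᵛ {V} E within r = sumMap-cong _ _ (subsets E) (λ S m →
    weight-↭ᵛ S (EdgesIn-⊆ {V} {E} {S} within (∈-subsets⇒⊆ E m)) r)

  qOn-relabel : ∀ σ V E → EdgesIn V E → StrictlyMonotoneOn V σ → qOn (map σ V) (map (mapEdge σ) E) ≡ qOn V E
  qOn-relabel σ V E within mono = trans (sumSubsets-map (weight (map σ V)) (mapEdge σ) E)
    (sumMap-cong _ _ (subsets E) (λ S m → Relabel.weight-relabel σ V S (EdgesIn-⊆ {V} {E} {S} within (∈-subsets⇒⊆ E m)) mono))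

  -- Decomposition at a cut vertex

  edgesInᵇ : List ℕ → List Edge → Bool
  edgesInᵇ V A = all (λ e → mem (proj₁ e) V ∧ mem (proj₂ e) V) A

  edgesInᵇ⇒EdgesIn : ∀ V A → edgesInᵇ V A ≡ true → EdgesIn V A
  edgesInᵇ⇒EdgesIn V A h m = ∧-true⁻ (all⁻ (λ e → mem (proj₁ e) V ∧ mem (proj₂ e) V) h m)

  -- A small piece glued to the rest of a graph is described on the local vertices 0 ∷ P, where 0 is
  -- the cut vertex. For a set A of local edges, breaksAt P A p says that p ∈ P lies in a component
  -- that is neither an edge nor a cycle once one more edge at the cut vertex is added to A.
  touchesCut : List Edge → Bool
  touchesCut A = 1 ≤ᵇ deg A 0

  breaksAt : List ℕ → List Edge → ℕ → Bool
  breaksAt P A p = (deg A p ≡ᵇ 0) ∨ (not (deg A p ≡ᵇ 2) ∧ ((2 ≤ᵇ deg A p) ∨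
    ((adj A p 0 ∧ (1 ≤ᵇ deg A 0)) ∨ any (λ w → adj A p w ∧ (2 ≤ᵇ deg A w)) P)))

  breaksWithCutEdge : List ℕ → List Edge → Bool
  breaksWithCutEdge P A = (2 ≤ᵇ deg A 0) ∨ any (breaksAt P A) P

  cutCompatible : List ℕ → List Edge → Bool
  cutCompatible P A = if touchesCut A then edgesInᵇ (0 ∷ P) A ∧ breaksWithCutEdge P A else edgesInᵇ P A

  isCutPiece : List ℕ → List Edge → Bool
  isCutPiece P L = all (cutCompatible P) (subsets L)

  coveredCoeff : List ℕ → List Edge → ℤ
  coveredCoeff P L = sumSubsets (λ A → if touchesCut A then weight (0 ∷ P) A else ℤ.0ℤ) L

  uncoveredCoeff : List ℕ → List Edge → ℤ
  uncoveredCoeff P L = sumSubsets (λ A → if touchesCut A then ℤ.0ℤ else weight P A) L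

  if-*-split : ∀ (b : Bool) a c X Y → (if b then a ℤ.* X else c ℤ.* Y) ≡
    (if b then a else ℤ.0ℤ) ℤ.* X ℤ.+ (if b then ℤ.0ℤ else c) ℤ.* Y
  if-*-split true a c X Y = sym (trans (cong (λ t → a ℤ.* X ℤ.+ t) (ℤₚ.*-zeroˡ Y)) (ℤₚ.+-identityʳ _))
  if-*-split false a c X Y = sym (trans (cong (λ t → t ℤ.+ c ℤ.* Y) (ℤₚ.*-zeroˡ X)) (ℤₚ.+-identityˡ _))

  mem-≢ᵇ : ∀ x y {V} → mem x V ≡ true → mem y V ≡ false → (x ≡ᵇ y) ≡ false
  mem-≢ᵇ x y x∈V y∉V = ≢⇒≡ᵇ-false {x} {y} λ { refl → contradiction (trans (sym x∈V) y∉V) λ () }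

  -- The graph (V, E) is the piece (ℓ (0 ∷ P), ℓ L) glued at the cut vertex ℓ 0 to the rest
  -- (ℓ 0 ∷ W, Ec ++ Ew), where the edges Ec are incident to ℓ 0. If a spanning elementary subgraph covers
  -- the cut vertex by local edges, the certificate rules out every edge of Ec and what remains is a
  -- spanning elementary subgraph of (W, Ew); otherwise the piece minus the cut vertex splits off.
  module CutDecomposition (P : List ℕ) (L : List Edge) (certified : isCutPiece P L ≡ true)
    (ℓ : ℕ → ℕ) (mono : StrictlyMonotoneOn (0 ∷ P) ℓ)
    (V W : List ℕ) (Ec Ew E : List Edge)
    (layoutV : V ↭ map ℓ P ++ (ℓ 0 ∷ W))
    (layoutE : E ↭ map (mapEdge ℓ) L ++ (Ec ++ Ew))
    (withinᶜ : EdgesIn (ℓ 0 ∷ W) Ec) (atCut : ∀ {e} → e ∈ Ec → incident (ℓ 0) e ≡ true)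
    (withinʷ : EdgesIn W Ew)
    (P-fresh : ∀ p → p ∈ P → mem (ℓ p) (ℓ 0 ∷ W) ≡ false)
    (cut-fresh : mem (ℓ 0) W ≡ false) where

    F = 0 ∷ P
    Rest = ℓ 0 ∷ W
    Er = Ec ++ Ew

    mono-P : StrictlyMonotoneOn P ℓ
    mono-P a b a∈P b∈P = mono a b (mem-∷⁺ʳ a 0 P a∈P) (mem-∷⁺ʳ b 0 P b∈P)

    mem-V : ∀ z → mem z V ≡ (mem z (map ℓ P) ∨ mem z Rest)
    mem-V z = trans (mem-↭ {z} layoutV) (mem-++ z (map ℓ P) Rest)

    local∈V : ∀ p → p ∈ P → mem (ℓ p) V ≡ true
    local∈V p m rewrite mem-V (ℓ p) | ∈⇒mem (∈-map⁺ ℓ m) = refl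

    rest∈V : ∀ z → mem z Rest ≡ true → mem z V ≡ true
    rest∈V z e rewrite mem-V z | e = Boolₚ.∨-zeroʳ _

    cut∈V : mem (ℓ 0) V ≡ true
    cut∈V = rest∈V (ℓ 0) (cong (_∨ mem (ℓ 0) W) (≡ᵇ-refl (ℓ 0)))

    within-rest : EdgesIn Rest Er
    within-rest {e} m with ∈-++⁻ Ec m
    ... | inj₁ m₁ = withinᶜ m₁
    ... | inj₂ m₂ = let (a , b) = withinʷ m₂ in mem-∷⁺ʳ (proj₁ e) (ℓ 0) W a , mem-∷⁺ʳ (proj₂ e) (ℓ 0) W b

    ℓF∈V : ∀ z → mem z (map ℓ F) ≡ true → mem z V ≡ true
    ℓF∈V z e with ∈-map⁻ ℓ (mem⇒∈ {z} (map ℓ F) e)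
    ... | .0 , here refl , refl = cut∈V
    ... | p , there m , refl = local∈V p m

    disjoint-ℓF : Disjoint (map ℓ F) W
    disjoint-ℓF z e with ∈-map⁻ ℓ (mem⇒∈ {z} (map ℓ F) e)
    ... | .0 , here refl , refl = cut-fresh
    ... | p , there m , refl = ∨-false⁻ʳ {ℓ p ≡ᵇ ℓ 0} (P-fresh p m)

    disjoint-ℓP : Disjoint (map ℓ P) Rest
    disjoint-ℓP z e with ∈-map⁻ ℓ (mem⇒∈ {z} (map ℓ P) e)
    ... | p , m , refl = P-fresh p m

    module Uncovered (A : List Edge) (within : EdgesIn P A) where

      sum : sumSubsets (λ B → weight V (map (mapEdge ℓ) A ++ B)) Er ≡ weight P A ℤ.* qOn Rest Er
      sum = trans (sumMap-cong _ _ (subsets Er) (λ B m →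
              trans (weight-disjoint V (map ℓ P) Rest (map (mapEdge ℓ) A) B layoutV
                       (Relabel.within′ ℓ P A within mono-P) (EdgesIn-⊆ {Rest} {Er} {B} within-rest (∈-subsets⇒⊆ Er m))
                       disjoint-ℓP)
                    (cong (ℤ._* weight Rest B) (Relabel.weight-relabel ℓ P A within mono-P))))
            (sumMap-*ˡ (weight Rest) (weight P A) (subsets Er))

    module Covered (A : List Edge) (within : EdgesIn F A) (breaks : breaksWithCutEdge P A ≡ true) where

      module Extended (y : Edge) (y∈Ec : y ∈ Ec) (T : List Edge) (T⊆Er : ∀ {e} → e ∈ T → e ∈ Er) where

        S = map (mapEdge ℓ) A ++ (y ∷ T)

        within-yT : EdgesIn Rest (y ∷ T)
        within-yT (here refl) = withinᶜ y∈Ec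
        within-yT (there m) = within-rest (T⊆Er m)

        within-S : EdgesIn V S
        within-S {e} m with ∈-++⁻ (map (mapEdge ℓ) A) m
        ... | inj₁ m₁ = let (a , b) = Relabel.within′ ℓ F A within mono m₁ in ℓF∈V (proj₁ e) a , ℓF∈V (proj₂ e) b
        ... | inj₂ m₂ = let (a , b) = within-yT m₂ in rest∈V (proj₁ e) a , rest∈V (proj₂ e) b

        deg-S : ∀ z → deg S z ≡ count (incident z) (map (mapEdge ℓ) A) + count (incident z) (y ∷ T)
        deg-S z = count-++ (incident z) (map (mapEdge ℓ) A) (y ∷ T)

        deg-ℓ : ∀ a → a ∈ F → count (incident (ℓ a)) (map (mapEdge ℓ) A) ≡ deg A a
        deg-ℓ a m = Relabel.deg-σ ℓ F A within mono a (∈⇒mem m)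

        deg-local : ∀ p → p ∈ P → deg S (ℓ p) ≡ deg A p
        deg-local p m = trans (deg-S (ℓ p)) (trans (cong₂ _+_ (deg-ℓ p (there m))
          (count-zero _ (y ∷ T) (λ e e∈ → let (a , b) = within-yT e∈ in
              cong₂ _∨_ (mem-≢ᵇ (proj₁ e) (ℓ p) {Rest} a (P-fresh p m)) (mem-≢ᵇ (proj₂ e) (ℓ p) {Rest} b (P-fresh p m)))))
          (ℕₚ.+-identityʳ _))

        deg-cut : suc (deg A 0) ≤ deg S (ℓ 0)
        deg-cut = subst (suc (deg A 0) ≤_) (sym (trans (deg-S (ℓ 0)) (cong (_+ count (incident (ℓ 0)) (y ∷ T)) (deg-ℓ 0 (here refl)))))
          (subst (_≤ deg A 0 + count (incident (ℓ 0)) (y ∷ T)) (ℕₚ.+-comm (deg A 0) 1)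
            (ℕₚ.+-monoʳ-≤ (deg A 0) (count-pos (incident (ℓ 0)) (y ∷ T) (here refl) (atCut y∈Ec))))

        adj-ℓ : ∀ a b → a ∈ F → b ∈ F → adj A a b ≡ true → adj S (ℓ a) (ℓ b) ≡ true
        adj-ℓ a b a∈F b∈F h = trans (any-++ _ (map (mapEdge ℓ) A) (y ∷ T))
          (cong (_∨ adj (y ∷ T) (ℓ a) (ℓ b)) (trans (Relabel.adj-σ ℓ F A within mono a b (∈⇒mem a∈F) (∈⇒mem b∈F)) h))

        heavy-neighbour : ∀ p → p ∈ P →
          ((2 ≤ᵇ deg A p) ∨ ((adj A p 0 ∧ (1 ≤ᵇ deg A 0)) ∨ any (λ w → adj A p w ∧ (2 ≤ᵇ deg A w)) P)) ≡ true →
          ∃[ w ] (Reach S (ℓ p) w × 2 ≤ deg S w)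
        heavy-neighbour p m h with ∨-true⁻ {2 ≤ᵇ deg A p} h
        ... | inj₁ x = ℓ p , start , subst (2 ≤_) (sym (deg-local p m)) (≤ᵇ⇒≤ x)
        ... | inj₂ x with ∨-true⁻ {adj A p 0 ∧ (1 ≤ᵇ deg A 0)} x
        ...   | inj₁ x₀ = let (p~0 , d) = ∧-true⁻ x₀ in
                  ℓ 0 , extend start (adj-ℓ p 0 (there m) (here refl) p~0) , ℕₚ.≤-trans (s≤s (≤ᵇ⇒≤ d)) deg-cut
        ...   | inj₂ x₁ with any⁻ _ P x₁
        ...     | w , w∈P , hw = let (p~w , d) = ∧-true⁻ hw in
                  ℓ w , extend start (adj-ℓ p w (there m) (there w∈P) p~w) , subst (2 ≤_) (sym (deg-local w w∈P)) (≤ᵇ⇒≤ d)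

        local-defect : ∀ p → p ∈ P → breaksAt P A p ≡ true → Defect S (ℓ p)
        local-defect p m b with ∨-true⁻ {deg A p ≡ᵇ 0} b
        ... | inj₁ d≡0 = isolated (trans (deg-local p m) (≡ᵇ⇒≡ d≡0))
        ... | inj₂ rest with ∧-true⁻ {not (deg A p ≡ᵇ 2)} rest
        ...   | d≢2 , heavy with heavy-neighbour p m heavy
        ...     | w , p⇝w , 2≤d = branching (not-≡ᵇ⇒≢ d≢2 ∘ trans (sym (deg-local p m))) p⇝w 2≤d

        weight≡0 : weight V S ≡ ℤ.0ℤ
        weight≡0 with ∨-true⁻ {2 ≤ᵇ deg A 0} breaks
        ... | inj₁ 2≤d = weight-defect V S (ℓ 0) within-S cut∈V (branching (ℕₚ.>⇒≢ 2<d) start (ℕₚ.<⇒≤ 2<d))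
          where 2<d = ℕₚ.<-≤-trans (s≤s (≤ᵇ⇒≤ 2≤d)) deg-cut
        ... | inj₂ b with any⁻ (breaksAt P A) P b
        ...   | p , m , bp = weight-defect V S (ℓ p) within-S (local∈V p m) (local-defect p m bp)

      sum : sumSubsets (λ B → weight V (map (mapEdge ℓ) A ++ B)) Er ≡ weight F A ℤ.* qOn W Ew
      sum = begin
        sumSubsets (λ B → weight V (ℓA ++ B)) (Ec ++ Ew)
          ≡⟨ sumSubsets-++ (λ B → weight V (ℓA ++ B)) Ec Ew ⟩
        sumSubsets (λ B₁ → sumSubsets (λ B₂ → weight V (ℓA ++ (B₁ ++ B₂))) Ew) Ec
          ≡⟨ sumSubsets-only-[] _ Ec (λ y y∈ B₁ B₁∈ → sumMap-zero _ (subsets Ew) (λ B₂ B₂∈ →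
               Extended.weight≡0 y y∈ (B₁ ++ B₂) (⊆Er B₁ B₂ B₁∈ B₂∈))) ⟩
        sumSubsets (λ B₂ → weight V (ℓA ++ B₂)) Ew
          ≡⟨ sumMap-cong _ _ (subsets Ew) (λ B₂ m →
               trans (weight-disjoint V (map ℓ F) W ℓA B₂ layoutV′ (Relabel.within′ ℓ F A within mono)
                        (EdgesIn-⊆ {W} {Ew} {B₂} withinʷ (∈-subsets⇒⊆ Ew m)) disjoint-ℓF)
                     (cong (ℤ._* weight W B₂) (Relabel.weight-relabel ℓ F A within mono))) ⟩
        sumMap (λ B₂ → weight F A ℤ.* weight W B₂) (subsets Ew)
          ≡⟨ sumMap-*ˡ (weight W) (weight F A) (subsets Ew) ⟩
        weight F A ℤ.* qOn W Ew ∎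
        where
        open ≡-Reasoning
        ℓA = map (mapEdge ℓ) A
        layoutV′ : V ↭ map ℓ F ++ W
        layoutV′ = ↭-trans layoutV (↭ₚ.shift (ℓ 0) (map ℓ P) W)
        ⊆Er : ∀ B₁ B₂ → B₁ ∈ subsets Ec → B₂ ∈ subsets Ew → ∀ {e} → e ∈ B₁ ++ B₂ → e ∈ Er
        ⊆Er B₁ B₂ B₁∈ B₂∈ e∈ with ∈-++⁻ B₁ e∈
        ... | inj₁ m₁ = ∈-++⁺ˡ (∈-subsets⇒⊆ Ec B₁∈ m₁)
        ... | inj₂ m₂ = ∈-++⁺ʳ Ec (∈-subsets⇒⊆ Ew B₂∈ m₂)

    compatible : ∀ A → A ∈ subsets L → ∀ {t} → touchesCut A ≡ t →
      (if t then edgesInᵇ F A ∧ breaksWithCutEdge P A else edgesInᵇ P A) ≡ true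
    compatible A m eq = subst (λ b → (if b then edgesInᵇ F A ∧ breaksWithCutEdge P A else edgesInᵇ P A) ≡ true) eq
      (all⁻ (cutCompatible P) certified m)

    local-sum : ∀ A → A ∈ subsets L → sumSubsets (λ B → weight V (map (mapEdge ℓ) A ++ B)) Er ≡
      (if touchesCut A then weight F A ℤ.* qOn W Ew else weight P A ℤ.* qOn Rest Er)
    local-sum A m with touchesCut A in touch
    ... | true = let (w , b) = ∧-true⁻ {edgesInᵇ F A} (compatible A m touch) in Covered.sum A (edgesInᵇ⇒EdgesIn F A w) b
    ... | false = Uncovered.sum A (edgesInᵇ⇒EdgesIn P A (compatible A m touch))

    qOn-cut : qOn V E ≡ coveredCoeff P L ℤ.* qOn W Ew ℤ.+ uncoveredCoeff P L ℤ.* qOn Rest Er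
    qOn-cut = begin
      qOn V E                                                        ≡⟨ qOn-↭ᵉ V layoutE ⟩
      sumSubsets (weight V) (map (mapEdge ℓ) L ++ Er)                ≡⟨ sumSubsets-++ (weight V) (map (mapEdge ℓ) L) Er ⟩
      sumSubsets local (map (mapEdge ℓ) L)                           ≡⟨ sumSubsets-map local (mapEdge ℓ) L ⟩
      sumMap (λ A → local (map (mapEdge ℓ) A)) (subsets L)
        ≡⟨ sumMap-cong _ _ (subsets L) (λ A m → trans (local-sum A m)
             (if-*-split (touchesCut A) (weight F A) (weight P A) (qOn W Ew) (qOn Rest Er))) ⟩
      sumMap (λ A → covered A ℤ.* qOn W Ew ℤ.+ uncovered A ℤ.* qOn Rest Er) (subsets L)
        ≡⟨ sumMap-+ _ _ (subsets L) ⟩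
      _ ≡⟨ cong₂ ℤ._+_ (sumMap-*ʳ covered (qOn W Ew) (subsets L)) (sumMap-*ʳ uncovered (qOn Rest Er) (subsets L)) ⟩
      coveredCoeff P L ℤ.* qOn W Ew ℤ.+ uncoveredCoeff P L ℤ.* qOn Rest Er ∎
      where
      open ≡-Reasoning
      local : List Edge → ℤ
      local A′ = sumSubsets (λ B → weight V (A′ ++ B)) Er
      covered uncovered : List Edge → ℤ
      covered A = if touchesCut A then weight F A else ℤ.0ℤ
      uncovered A = if touchesCut A then ℤ.0ℤ else weight P A

module PathsWithHouses where

  open import Data.Nat using (ℕ; zero; suc; _+_; _*_; _∸_; _<ᵇ_; _≡ᵇ_; _<_; _≤_; z≤n; s≤s)
  import Data.Nat.Properties as ℕₚ
  open import Data.Nat.Tactic.RingSolver using (solve-∀)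
  open import Data.Bool using (true; false; _∨_; if_then_else_; T)
  import Data.Bool.Properties as Boolₚ
  open import Data.Unit using (tt)
  open import Data.Product using (_×_; _,_; proj₁; proj₂)
  open import Data.Sum using (_⊎_; inj₁; inj₂)
  open import Data.List using (List; []; _∷_; [_]; _++_; _∷ʳ_; map; length; upTo; applyUpTo)
  import Data.List.Properties as Listₚ
  open import Data.List.Membership.Propositional using (_∈_)
  open import Data.List.Membership.Propositional.Properties using (∈-map⁺; ∈-map⁻; ∈-++⁻)
  open import Data.List.Relation.Unary.Any using (here; there)
  open import Data.List.Relation.Unary.Linked using (Linked; [-]; _∷_)
  open import Data.List.Relation.Binary.Permutation.Propositional as ↭ using (_↭_; ↭-trans; ↭-reflexive)
  import Data.List.Relation.Binary.Permutation.Propositional.Properties as ↭ₚ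
  open import Data.Integer as ℤ using (ℤ; +_)
  import Data.Integer.Tactic.RingSolver as ℤ-Solver
  import Algebra.Solver.CommutativeMonoid
  open import Function using (_∘_)
  open import Relation.Binary.PropositionalEquality hiding ([_])
  open import Relation.Nullary using (contradiction)
  open import Defs
  open ElementarySums

  range : ℕ → ℕ → List ℕ
  range a zero = []
  range a (suc n) = a ∷ range (suc a) n

  applyUpTo≡range : ∀ (f : ℕ → ℕ) a n → (∀ i → f i ≡ a + i) → applyUpTo f n ≡ range a n
  applyUpTo≡range f a zero h = refl
  applyUpTo≡range f a (suc n) h = cong₂ _∷_ (trans (h 0) (ℕₚ.+-identityʳ a))
    (applyUpTo≡range (λ i → f (suc i)) (suc a) n (λ i → trans (h (suc i)) (ℕₚ.+-suc a i)))

  upTo≡range : ∀ n → upTo n ≡ range 0 n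
  upTo≡range n = applyUpTo≡range (λ i → i) 0 n (λ i → refl)

  range-++ : ∀ a m n {b} → a + m ≡ b → range a (m + n) ≡ range a m ++ range b n
  range-++ a zero n refl = cong (λ b → range b n) (sym (ℕₚ.+-identityʳ a))
  range-++ a (suc m) n refl = cong (a ∷_) (range-++ (suc a) m n (sym (ℕₚ.+-suc a m)))

  range-∈⁻ : ∀ {z} a n → z ∈ range a n → a ≤ z × z < a + n
  range-∈⁻ a (suc n) (here refl) = ℕₚ.≤-refl , subst (a <_) (sym (ℕₚ.+-suc a n)) (s≤s (ℕₚ.m≤m+n a n))
  range-∈⁻ {z} a (suc n) (there m) = let (lo , hi) = range-∈⁻ (suc a) n m in
    ℕₚ.<⇒≤ lo , subst (z <_) (sym (ℕₚ.+-suc a n)) hi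

  range-∈⁺ : ∀ {z} a n → a ≤ z → z < a + n → z ∈ range a n
  range-∈⁺ a zero lo hi =
    contradiction (ℕₚ.<-≤-trans hi (ℕₚ.≤-trans (ℕₚ.≤-reflexive (ℕₚ.+-identityʳ a)) lo)) (ℕₚ.<-irrefl refl)
  range-∈⁺ {z} a (suc n) lo hi with ℕₚ.m≤n⇒m<n∨m≡n lo
  ... | inj₂ refl = here refl
  ... | inj₁ lt = there (range-∈⁺ (suc a) n lt (subst (z <_) (ℕₚ.+-suc a n) hi))

  mem-range : ∀ z a n → a ≤ z → z < a + n → mem z (range a n) ≡ true
  mem-range z a n lo hi = ∈⇒mem (range-∈⁺ a n lo hi)

  mem-range-false : ∀ z a n → z < a ⊎ a + n ≤ z → mem z (range a n) ≡ false
  mem-range-false z a n outside = ∉⇒mem-false (range a n) (λ m → let (lo , hi) = range-∈⁻ a n m in excluded outside lo hi)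
    where excluded : z < a ⊎ a + n ≤ z → a ≤ z → z < a + n → _
          excluded (inj₁ z<a) lo hi = ℕₚ.<⇒≱ z<a lo
          excluded (inj₂ a+n≤z) lo hi = ℕₚ.<⇒≱ hi a+n≤z

  mem-upTo : ∀ z N → z < N → mem z (upTo N) ≡ true
  mem-upTo z N lt rewrite upTo≡range N = mem-range z 0 N z≤n lt

  shiftFrom : ℕ → ℕ → ℕ → ℕ
  shiftFrom t p j = if j <ᵇ t then j else j + p

  shiftFrom-below : ∀ t p j → j < t → shiftFrom t p j ≡ j
  shiftFrom-below t p j lt with j <ᵇ t in eq
  ... | true = refl
  ... | false = contradiction (ℕₚ.<⇒<ᵇ lt) (subst T eq)

  shiftFrom-above : ∀ t p j → t ≤ j → shiftFrom t p j ≡ j + p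
  shiftFrom-above t p j le with j <ᵇ t in eq
  ... | true = contradiction le (ℕₚ.<⇒≱ (ℕₚ.<ᵇ⇒< j t (subst T (sym eq) tt)))
  ... | false = refl

  shiftFrom-mono : ∀ t p a b → a < b → shiftFrom t p a < shiftFrom t p b
  shiftFrom-mono t p a b lt with a <ᵇ t in ea | b <ᵇ t in eb
  ... | true | true = lt
  ... | true | false = ℕₚ.<-≤-trans lt (ℕₚ.m≤m+n b p)
  ... | false | true = contradiction (ℕₚ.≤-<-trans t≤a lt) (ℕₚ.<⇒≯ (ℕₚ.<ᵇ⇒< b t (subst T (sym eb) tt)))
    where t≤a : t ≤ a
          t≤a = ℕₚ.≮⇒≥ (λ a<t → subst T ea (ℕₚ.<⇒<ᵇ a<t))
  ... | false | false = ℕₚ.+-monoˡ-< p lt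

  map-shiftFrom-below : ∀ t p a n → a + n ≤ t → map (shiftFrom t p) (range a n) ≡ range a n
  map-shiftFrom-below t p a zero le = refl
  map-shiftFrom-below t p a (suc n) le rewrite ℕₚ.+-suc a n =
    cong₂ _∷_ (shiftFrom-below t p a (ℕₚ.<-≤-trans (s≤s (ℕₚ.m≤m+n a n)) le)) (map-shiftFrom-below t p (suc a) n le)

  map-shiftFrom-above : ∀ t p a n → t ≤ a → map (shiftFrom t p) (range a n) ≡ range (a + p) n
  map-shiftFrom-above t p a zero le = refl
  map-shiftFrom-above t p a (suc n) le = cong₂ _∷_ (shiftFrom-above t p a le) (map-shiftFrom-above t p (suc a) n (ℕₚ.m≤n⇒m≤1+n le))

  pathEdge : ℕ → Edge
  pathEdge j = (j , suc j)

  map-shift-pathEdges : ∀ t p a n → a + n < t → map (mapEdge (shiftFrom t p)) (map pathEdge (range a n)) ≡ map pathEdge (range a n)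
  map-shift-pathEdges t p a zero lt = refl
  map-shift-pathEdges t p a (suc n) lt rewrite ℕₚ.+-suc a n = cong₂ _∷_
    (cong₂ _,_ (shiftFrom-below t p a (ℕₚ.<-trans (s≤s (ℕₚ.m≤m+n a n)) lt))
               (shiftFrom-below t p (suc a) (ℕₚ.≤-<-trans (s≤s (ℕₚ.m≤m+n a n)) lt)))
    (map-shift-pathEdges t p (suc a) n lt)

  houseEdges-++ : ∀ m i as bs → houseEdges m i (as ++ bs) ≡ houseEdges m i as ++ houseEdges m (i + length as) bs
  houseEdges-++ m i [] bs = cong (λ j → houseEdges m j bs) (sym (ℕₚ.+-identityʳ i))
  houseEdges-++ m i (a ∷ as) bs rewrite houseEdges-++ m (suc i) as bs | ℕₚ.+-suc i (length as) = refl

  map-shift-houseEdges : ∀ t p m i bs → t ≤ m → (∀ b → b ∈ bs → b < t) →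
    map (mapEdge (shiftFrom t p)) (houseEdges m i bs) ≡ houseEdges (m + p) i bs
  map-shift-houseEdges t p m i [] le h = refl
  map-shift-houseEdges t p m i (b ∷ bs) le h =
    cong₂ _∷_ (cong₂ _,_ b-1 x) (cong₂ _∷_ (cong₂ _,_ b-1 x+1) (cong₂ _∷_ (cong₂ _,_ b′ x) (cong₂ _∷_ (cong₂ _,_ b′ x+1)
      (cong₂ _∷_ (cong₂ _,_ x x+1) (map-shift-houseEdges t p m (suc i) bs le (λ b′ m′ → h b′ (there m′)))))))
    where
    b<t = h b (here refl)
    b-1 = shiftFrom-below t p (b ∸ 1) (ℕₚ.≤-<-trans (ℕₚ.m∸n≤m b 1) b<t)
    b′ = shiftFrom-below t p b b<t
    reorder : ∀ m i p → m + i + p ≡ m + p + i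
    reorder = solve-∀
    x = trans (shiftFrom-above t p (m + 2 * i) (ℕₚ.≤-trans le (ℕₚ.m≤m+n m _))) (reorder m (2 * i) p)
    x+1 = trans (shiftFrom-above t p (suc (m + 2 * i)) (ℕₚ.≤-trans le (ℕₚ.≤-trans (ℕₚ.m≤m+n m _) (ℕₚ.n≤1+n _))))
                (cong suc (reorder m (2 * i) p))

  qEdges : ℕ → List ℕ → List Edge
  qEdges m as = pathEdges m ++ houseEdges m 0 as

  q≡qOn : ∀ n as → q (+ n) as ≡ qOn (upTo (suc n + 2 * length as)) (qEdges (suc n) as)
  q≡qOn n as = qG≡qOn (suc n + 2 * length as) (qEdges (suc n) as)

  houseEdge-bound : ∀ m i bs → (∀ b → b ∈ bs → b < m) → ∀ {e} → e ∈ houseEdges m i bs →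
    proj₁ e < m + 2 * (i + length bs) × proj₂ e < m + 2 * (i + length bs)
  houseEdge-bound m i (b ∷ bs) below {e} = bound
    where
    B = m + 2 * (i + suc (length bs))
    b< : b < B
    b< = ℕₚ.<-≤-trans (below b (here refl)) (ℕₚ.m≤m+n m _)
    b-1< : b ∸ 1 < B
    b-1< = ℕₚ.≤-<-trans (ℕₚ.m∸n≤m b 1) b<
    layout : ∀ m i n → m + 2 * (i + suc n) ≡ suc (suc (m + 2 * i)) + 2 * n
    layout = solve-∀
    x+1< : suc (m + 2 * i) < B
    x+1< = subst (suc (m + 2 * i) <_) (sym (layout m i (length bs))) (ℕₚ.m≤m+n _ _)
    x< : m + 2 * i < B
    x< = ℕₚ.<-trans (ℕₚ.n<1+n _) x+1<
    bound : e ∈ houseEdges m i (b ∷ bs) → proj₁ e < B × proj₂ e < B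
    bound (here refl) = b-1< , x<
    bound (there (here refl)) = b-1< , x+1<
    bound (there (there (here refl))) = b< , x<
    bound (there (there (there (here refl)))) = b< , x+1<
    bound (there (there (there (there (here refl))))) = x< , x+1<
    bound (there (there (there (there (there e∈))))) =
      subst (λ B → proj₁ e < B × proj₂ e < B) (cong (λ j → m + 2 * j) (sym (ℕₚ.+-suc i (length bs))))
        (houseEdge-bound m (suc i) bs (λ b′ m′ → below b′ (there m′)) e∈)

  EdgesIn-Q : ∀ m as → (∀ a → a ∈ as → a < m) → EdgesIn (upTo (m + 2 * length as)) (qEdges m as)
  EdgesIn-Q m as below {e} e∈ with ∈-++⁻ (pathEdges m) e∈
  ... | inj₁ e∈path = path-bound m e∈path
    where
    path-bound : ∀ m → e ∈ pathEdges m →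
      mem (proj₁ e) (upTo (m + 2 * length as)) ≡ true × mem (proj₂ e) (upTo (m + 2 * length as)) ≡ true
    path-bound (suc k) e∈′ with ∈-map⁻ pathEdge e∈′
    ... | j , j∈ , refl =
      let j<k = proj₂ (range-∈⁻ {j} 0 k (subst (j ∈_) (upTo≡range k) j∈)) in
      mem-upTo j _ (ℕₚ.≤-trans (ℕₚ.m≤n⇒m≤1+n j<k) (ℕₚ.m≤m+n (suc k) _)) ,
      mem-upTo (suc j) _ (ℕₚ.≤-trans (s≤s j<k) (ℕₚ.m≤m+n (suc k) _))
  ... | inj₂ e∈houses = let (lo , hi) = houseEdge-bound m 0 as below e∈houses in
    mem-upTo (proj₁ e) _ lo , mem-upTo (proj₂ e) _ hi

  range-∷ʳ : ∀ a n → range a (suc n) ≡ range a n ++ [ a + n ]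
  range-∷ʳ a n = trans (cong (range a) (ℕₚ.+-comm 1 n)) (range-++ a n 1 refl)

  nth : List ℕ → ℕ → ℕ
  nth [] i = 0
  nth (v ∷ vs) zero = v
  nth (v ∷ vs) (suc i) = nth vs i

  map-nth-range : ∀ vs → map (nth vs) (range 0 (length vs)) ≡ vs
  map-nth-range [] = refl
  map-nth-range (v ∷ vs) = cong (v ∷_) (trans (map-nth-suc 0 (length vs)) (map-nth-range vs))
    where map-nth-suc : ∀ a n → map (nth (v ∷ vs)) (range (suc a) n) ≡ map (nth vs) (range a n)
          map-nth-suc a zero = refl
          map-nth-suc a (suc n) = cong (nth vs a ∷_) (map-nth-suc (suc a) n)

  nth-head-≤ : ∀ v vs → Linked _<_ (v ∷ vs) → ∀ j → j < length (v ∷ vs) → v ≤ nth (v ∷ vs) j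
  nth-head-≤ v vs _ zero _ = ℕₚ.≤-refl
  nth-head-≤ v (w ∷ vs) (v<w ∷ l) (suc j) (s≤s j<) = ℕₚ.≤-trans (ℕₚ.<⇒≤ v<w) (nth-head-≤ w vs l j j<)

  nth-mono : ∀ vs → Linked _<_ vs → StrictlyMonotoneOn (range 0 (length vs)) (nth vs)
  nth-mono vs l i j _ j∈ i<j = mono vs l i j i<j (proj₂ (range-∈⁻ {j} 0 (length vs) (mem⇒∈ (range 0 (length vs)) j∈)))
    where
    mono : ∀ vs → Linked _<_ vs → ∀ i j → i < j → j < length vs → nth vs i < nth vs j
    mono (v ∷ w ∷ vs) (v<w ∷ l) zero (suc j) _ (s≤s j<) = ℕₚ.<-≤-trans v<w (nth-head-≤ w vs l j j<)
    mono (v ∷ w ∷ vs) (_ ∷ l) (suc i) (suc j) (s≤s i<j) (s≤s j<) = mono (w ∷ vs) l i j i<j j<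
    mono (v ∷ []) _ zero (suc j) _ (s≤s ())
    mono (v ∷ []) _ (suc i) (suc j) _ (s≤s ())

  module PermutationSolver {A : Set} = Algebra.Solver.CommutativeMonoid (↭ₚ.++-commutativeMonoid {A = A})

  -- The graph Q(k + t + 1; bs ++ hs) cut at the path vertex s = t + 1: on the left the path 0 … t carrying
  -- the houses bs, i.e. Q(t; bs) with its house vertices renumbered; on the right the k further path
  -- vertices and the houses hs, whose vertices become the local vertices 1, 2, … of the piece.
  module GluedPiece (t k : ℕ) (bs hs : List ℕ) (bs-below : ∀ b → b ∈ bs → b ≤ t) where

    s n m x : ℕ
    s = suc t
    n = length bs
    m = suc (k + s)
    x = m + 2 * n

    locals : List ℕ
    locals = range (suc s) k ++ range x (2 * length hs)

    P : List ℕ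
    P = range 1 (length locals)

    ℓ : ℕ → ℕ
    ℓ = nth (s ∷ locals)

    σ : ℕ → ℕ
    σ = shiftFrom s (suc k)

    X Y W : List ℕ
    X = range 0 s
    Y = range m (2 * n)
    W = map σ (upTo (s + 2 * n))

    path houses Ew : List Edge
    path = map pathEdge (range 0 t)
    houses = houseEdges m 0 bs
    Ew = map (mapEdge σ) (qEdges s bs)

    s+suc-k : s + suc k ≡ m
    s+suc-k = trans (ℕₚ.+-suc s k) (cong suc (ℕₚ.+-comm s k))

    b<s : ∀ b → b ∈ bs → b < s
    b<s b b∈ = s≤s (bs-below b b∈)

    W≡ : W ≡ X ++ Y
    W≡ = begin
      map σ (upTo (s + 2 * n))                        ≡⟨ cong (map σ) (trans (upTo≡range _) (range-++ 0 s (2 * n) refl)) ⟩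
      map σ (X ++ range s (2 * n))                    ≡⟨ Listₚ.map-++ σ X (range s (2 * n)) ⟩
      map σ X ++ map σ (range s (2 * n))              ≡⟨ cong₂ _++_ (map-shiftFrom-below s (suc k) 0 s ℕₚ.≤-refl)
                                                          (map-shiftFrom-above s (suc k) s (2 * n) ℕₚ.≤-refl) ⟩
      X ++ range (s + suc k) (2 * n)                  ≡⟨ cong (λ a → X ++ range a (2 * n)) s+suc-k ⟩
      X ++ Y                                          ∎
      where open ≡-Reasoning

    Ew≡ : Ew ≡ path ++ houses
    Ew≡ = trans (Listₚ.map-++ (mapEdge σ) (pathEdges s) (houseEdges s 0 bs))
      (cong₂ _++_ (trans (cong (map (mapEdge σ) ∘ map pathEdge) (upTo≡range t)) (map-shift-pathEdges s (suc k) 0 t ℕₚ.≤-refl))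
                  (trans (map-shift-houseEdges s (suc k) s 0 bs ℕₚ.≤-refl b<s) (cong (λ a → houseEdges a 0 bs) s+suc-k)))

    within-prefix : EdgesIn (upTo (s + 2 * n)) (qEdges s bs)
    within-prefix = EdgesIn-Q s bs b<s

    σ-mono : StrictlyMonotoneOn (upTo (s + 2 * n)) σ
    σ-mono a b _ _ = shiftFrom-mono s (suc k) a b

    q-left : qOn W Ew ≡ q (+ t) bs
    q-left = trans (qOn-relabel σ (upTo (s + 2 * n)) (qEdges s bs) within-prefix σ-mono) (sym (q≡qOn t bs))

    s∉W : ∀ z → s ≤ z → z < m ⊎ x ≤ z → mem z W ≡ false
    s∉W z s≤z outside = subst (λ Z → mem z Z ≡ false) (sym W≡) (trans (mem-++ z X Y)
      (cong₂ _∨_ (mem-range-false z 0 s (inj₂ s≤z)) (mem-range-false z m (2 * n) outside)))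

    Vᵍ : List ℕ
    Vᵍ = upTo (m + 2 * length (bs ++ hs))
    Eᵍ : List Edge
    Eᵍ = qEdges m (bs ++ hs)

    Vᵍ≡ : Vᵍ ≡ X ++ (s ∷ (range (suc s) k ++ (Y ++ range x (2 * length hs))))
    Vᵍ≡ = begin
      upTo (m + 2 * length (bs ++ hs))                         ≡⟨ upTo≡range _ ⟩
      range 0 (m + 2 * length (bs ++ hs))                      ≡⟨ cong (λ l → range 0 (m + 2 * l)) (Listₚ.length-++ bs) ⟩
      range 0 (m + 2 * (n + h))                                ≡⟨ cong (range 0) (layout k s n h) ⟩
      range 0 (s + (suc k + (2 * n + 2 * h)))                  ≡⟨ range-++ 0 s _ refl ⟩
      X ++ range s (suc k + (2 * n + 2 * h))                   ≡⟨ cong (X ++_) (range-++ s (suc k) _ s+suc-k) ⟩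
      X ++ (s ∷ (range (suc s) k ++ range m (2 * n + 2 * h)))
        ≡⟨ cong (λ l → X ++ (s ∷ (range (suc s) k ++ l))) (range-++ m (2 * n) (2 * h) refl) ⟩
      X ++ (s ∷ (range (suc s) k ++ (Y ++ range x (2 * h))))   ∎
      where
      open ≡-Reasoning
      h = length hs
      layout : ∀ k s n h → suc (k + s) + 2 * (n + h) ≡ s + (suc k + (2 * n + 2 * h))
      layout = solve-∀

    Eᵍ≡ : Eᵍ ≡ (path ++ (pathEdge t ∷ map pathEdge (range s k))) ++ (houses ++ houseEdges m n hs)
    Eᵍ≡ = cong₂ _++_
      (trans (cong (map pathEdge) (trans (upTo≡range (k + s)) (trans (cong (range 0) (ℕₚ.+-comm k s))
                                           (trans (cong (range 0) (sym (ℕₚ.+-suc t k))) (range-++ 0 t (suc k) refl)))))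
             (Listₚ.map-++ pathEdge (range 0 t) _))
      (houseEdges-++ m 0 bs hs)

    q-right : EdgesIn (s ∷ W) (pathEdge t ∷ Ew) → qOn (s ∷ W) (pathEdge t ∷ Ew) ≡ q (+ s) bs
    q-right within = begin
      qOn (s ∷ W) (pathEdge t ∷ Ew)                ≡⟨ qOn-↭ᵛ _ within (↭-trans (↭-reflexive (cong (s ∷_) W≡)) shift-cut) ⟩
      qOn (map σ′ V′) (pathEdge t ∷ Ew)
        ≡⟨ qOn-↭ᵉ (map σ′ V′) (↭-trans (↭-reflexive (cong (pathEdge t ∷_) Ew≡)) shift-edge) ⟩
      qOn (map σ′ V′) (map (mapEdge σ′) E′)
        ≡⟨ qOn-relabel σ′ V′ E′ (EdgesIn-Q (suc s) bs b<suc-s) (λ a b _ _ → shiftFrom-mono (suc s) k a b) ⟩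
      qOn V′ E′                                    ≡⟨ q≡qOn s bs ⟨
      q (+ s) bs                                   ∎
      where
      open ≡-Reasoning
      open PermutationSolver
      σ′ = shiftFrom (suc s) k
      V′ = upTo (suc s + 2 * n)
      E′ = qEdges (suc s) bs
      b<suc-s : ∀ b → b ∈ bs → b < suc s
      b<suc-s b b∈ = ℕₚ.m≤n⇒m≤1+n (b<s b b∈)
      suc-s+k : suc s + k ≡ m
      suc-s+k = cong suc (ℕₚ.+-comm s k)
      σ′V′ : map σ′ V′ ≡ (X ++ [ s ]) ++ Y
      σ′V′ = begin
        map σ′ (upTo (suc s + 2 * n))                     ≡⟨ cong (map σ′) (trans (upTo≡range _) (range-++ 0 (suc s) (2 * n) refl)) ⟩
        map σ′ (range 0 (suc s) ++ range (suc s) (2 * n)) ≡⟨ Listₚ.map-++ σ′ (range 0 (suc s)) _ ⟩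
        _                                                 ≡⟨ cong₂ _++_ (map-shiftFrom-below (suc s) k 0 (suc s) ℕₚ.≤-refl)
                                                              (map-shiftFrom-above (suc s) k (suc s) (2 * n) ℕₚ.≤-refl) ⟩
        range 0 (suc s) ++ range (suc s + k) (2 * n)      ≡⟨ cong₂ _++_ (range-∷ʳ 0 s) (cong (λ a → range a (2 * n)) suc-s+k) ⟩
        (X ++ [ s ]) ++ Y                                 ∎
      σ′E′ : map (mapEdge σ′) E′ ≡ (path ++ [ pathEdge t ]) ++ houses
      σ′E′ = trans (Listₚ.map-++ (mapEdge σ′) (pathEdges (suc s)) (houseEdges (suc s) 0 bs))
        (cong₂ _++_ (trans (cong (map (mapEdge σ′) ∘ map pathEdge) (upTo≡range s))
                           (trans (map-shift-pathEdges (suc s) k 0 s ℕₚ.≤-refl)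
                                  (trans (cong (map pathEdge) (range-∷ʳ 0 t)) (Listₚ.map-++ pathEdge (range 0 t) [ t ]))))
                    (trans (map-shift-houseEdges (suc s) k (suc s) 0 bs ℕₚ.≤-refl b<suc-s) (cong (λ a → houseEdges a 0 bs) suc-s+k)))
      shift-cut : s ∷ (X ++ Y) ↭ map σ′ V′
      shift-cut = ↭-trans (solve 3 (λ c a b → c ⊕ (a ⊕ b) ⊜ (a ⊕ c) ⊕ b) ↭.refl [ s ] X Y) (↭-reflexive (sym σ′V′))
      shift-edge : pathEdge t ∷ (path ++ houses) ↭ map (mapEdge σ′) E′
      shift-edge = ↭-trans (solve 3 (λ c a b → c ⊕ (a ⊕ b) ⊜ (a ⊕ c) ⊕ b) ↭.refl [ pathEdge t ] path houses)
                           (↭-reflexive (sym σ′E′))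

    map-ℓ-P : map ℓ P ≡ locals
    map-ℓ-P = Listₚ.∷-injectiveʳ (map-nth-range (s ∷ locals))

    local-bounds : ∀ {z} → z ∈ locals → s < z × (z < m ⊎ x ≤ z)
    local-bounds {z} z∈ with ∈-++⁻ (range (suc s) k) z∈
    ... | inj₁ z∈path = let (lo , hi) = range-∈⁻ (suc s) k z∈path in
      lo , inj₁ (subst (z <_) (cong suc (ℕₚ.+-comm s k)) hi)
    ... | inj₂ z∈house = let (lo , _) = range-∈⁻ x (2 * length hs) z∈house in
      ℕₚ.<-≤-trans (s≤s (ℕₚ.m≤n+m s k)) (ℕₚ.≤-trans (ℕₚ.m≤m+n m (2 * n)) lo) , inj₂ lo

    module _ (L : List Edge) (certified : isCutPiece P L ≡ true) (increasing : Linked _<_ (s ∷ locals))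
             (local-edges : map (mapEdge ℓ) L ≡ map pathEdge (range s k) ++ houseEdges m n hs) where

      open PermutationSolver

      layoutV : Vᵍ ↭ map ℓ P ++ (ℓ 0 ∷ W)
      layoutV = ↭-trans (↭-reflexive Vᵍ≡)
        (↭-trans (solve 5 (λ x c a y b → x ⊕ (c ⊕ (a ⊕ (y ⊕ b))) ⊜ (a ⊕ b) ⊕ (c ⊕ (x ⊕ y))) ↭.refl
                          X [ s ] (range (suc s) k) Y (range x (2 * length hs)))
                 (↭-reflexive (cong₂ (λ l w → l ++ (s ∷ w)) (sym map-ℓ-P) (sym W≡))))

      layoutE : Eᵍ ↭ map (mapEdge ℓ) L ++ ([ pathEdge t ] ++ Ew)
      layoutE = ↭-trans (↭-reflexive Eᵍ≡)
        (↭-trans (solve 5 (λ p c a h h′ → (p ⊕ (c ⊕ a)) ⊕ (h ⊕ h′) ⊜ (a ⊕ h′) ⊕ (c ⊕ (p ⊕ h))) ↭.refl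
                          path [ pathEdge t ] (map pathEdge (range s k)) houses (houseEdges m n hs))
                 (↭-reflexive (cong₂ (λ l w → l ++ (pathEdge t ∷ w)) (sym local-edges) (sym Ew≡))))

      within-cut : EdgesIn (s ∷ W) [ pathEdge t ]
      within-cut (here refl) =
        mem-∷⁺ʳ t s W (subst (λ Z → mem t Z ≡ true) (sym W≡) (mem-++ˡ t X Y (mem-range t 0 s z≤n (ℕₚ.n<1+n t)))) ,
        cong (_∨ mem s W) (≡ᵇ-refl s)

      at-cut : ∀ {e} → e ∈ [ pathEdge t ] → incident s e ≡ true
      at-cut (here refl) = trans (cong ((t ≡ᵇ s) ∨_) (≡ᵇ-refl s)) (Boolₚ.∨-zeroʳ _)

      local-fresh : ∀ p → p ∈ P → mem (ℓ p) (s ∷ W) ≡ false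
      local-fresh p p∈ = let (s<z , outside) = local-bounds (subst (ℓ p ∈_) map-ℓ-P (∈-map⁺ ℓ p∈)) in
        cong₂ _∨_ (≢⇒≡ᵇ-false (ℕₚ.>⇒≢ s<z)) (s∉W (ℓ p) (ℕₚ.<⇒≤ s<z) outside)

      module Cut = CutDecomposition P L certified ℓ (nth-mono (s ∷ locals) increasing) Vᵍ W [ pathEdge t ] Ew Eᵍ
        layoutV layoutE within-cut at-cut (Relabel.within′ σ (upTo (s + 2 * n)) (qEdges s bs) within-prefix σ-mono)
        local-fresh (s∉W s ℕₚ.≤-refl (inj₁ (s≤s (ℕₚ.m≤n+m s k))))

      q-glued : q (+ (k + s)) (bs ++ hs) ≡ coveredCoeff P L ℤ.* q (+ t) bs ℤ.+ uncoveredCoeff P L ℤ.* q (+ s) bs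
      q-glued = trans (q≡qOn (k + s) (bs ++ hs)) (trans Cut.qOn-cut
        (cong₂ (λ a b → coveredCoeff P L ℤ.* a ℤ.+ uncoveredCoeff P L ℤ.* b) q-left (q-right Cut.within-rest)))

  -- The end pieces, with the cut vertex as local vertex 0: an edge, a 2-house followed by an edge, and a
  -- lone 2-house (a K₄).
  pendant : List Edge
  pendant = (0 , 1) ∷ []

  house-then-edge : List Edge
  house-then-edge = (0 , 1) ∷ (1 , 2) ∷ (0 , 3) ∷ (0 , 4) ∷ (1 , 3) ∷ (1 , 4) ∷ (3 , 4) ∷ []

  lone-house : List Edge
  lone-house = (0 , 1) ∷ (0 , 2) ∷ (0 , 3) ∷ (1 , 2) ∷ (1 , 3) ∷ (2 , 3) ∷ []

  pendant-certified : isCutPiece (range 1 1) pendant ≡ true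
  pendant-certified = refl

  pendant-covered : coveredCoeff (range 1 1) pendant ≡ ℤ.- (+ 1)
  pendant-covered = refl

  pendant-uncovered : uncoveredCoeff (range 1 1) pendant ≡ + 0
  pendant-uncovered = refl

  house-then-edge-certified : isCutPiece (range 1 4) house-then-edge ≡ true
  house-then-edge-certified = refl

  house-then-edge-covered : coveredCoeff (range 1 4) house-then-edge ≡ + 2
  house-then-edge-covered = refl

  house-then-edge-uncovered : uncoveredCoeff (range 1 4) house-then-edge ≡ + 1
  house-then-edge-uncovered = refl

  lone-house-certified : isCutPiece (range 1 3) lone-house ≡ true
  lone-house-certified = refl

  lone-house-covered : coveredCoeff (range 1 3) lone-house ≡ ℤ.- (+ 3)
  lone-house-covered = refl

  lone-house-uncovered : uncoveredCoeff (range 1 3) lone-house ≡ ℤ.- (+ 2)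
  lone-house-uncovered = refl

  pendant-coefficients : ∀ a b → ℤ.- (+ 1) ℤ.* a ℤ.+ + 0 ℤ.* b ≡ ℤ.- a
  pendant-coefficients = ℤ-Solver.solve-∀

  house-then-edge-coefficients : ∀ a b → + 2 ℤ.* a ℤ.+ + 1 ℤ.* b ≡ b ℤ.+ + 2 ℤ.* a
  house-then-edge-coefficients = ℤ-Solver.solve-∀

  lone-house-coefficients : ∀ a b → ℤ.- (+ 3) ℤ.* a ℤ.+ ℤ.- (+ 2) ℤ.* b ≡ ℤ.- (+ 2) ℤ.* b ℤ.- + 3 ℤ.* a
  lone-house-coefficients = ℤ-Solver.solve-∀

  q-pendant : ∀ t as → (∀ a → a ∈ as → a ≤ t) → q (+ suc (suc t)) as ≡ ℤ.- q (+ t) as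
  q-pendant t as below = begin
    q (+ suc (suc t)) as
      -- explicit endpoints: solving for them would make Agda unfold q
      ≡⟨ cong (q (+ suc (suc t))) {x = as} {y = as ++ []} (sym (Listₚ.++-identityʳ as)) ⟩
    q (+ suc (suc t)) (as ++ [])
      ≡⟨ q-glued pendant pendant-certified (ℕₚ.n<1+n _ ∷ [-]) refl ⟩
    coveredCoeff P pendant ℤ.* q (+ t) as ℤ.+ uncoveredCoeff P pendant ℤ.* q (+ suc t) as
      ≡⟨ cong₂ (λ a b → a ℤ.* q (+ t) as ℤ.+ b ℤ.* q (+ suc t) as) pendant-covered pendant-uncovered ⟩
    ℤ.- (+ 1) ℤ.* q (+ t) as ℤ.+ + 0 ℤ.* q (+ suc t) as
      ≡⟨ pendant-coefficients (q (+ t) as) (q (+ suc t) as) ⟩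
    ℤ.- q (+ t) as ∎
    where
    open ≡-Reasoning
    open GluedPiece t 1 as [] below

  q-house-then-edge : ∀ t bs → (∀ b → b ∈ bs → b ≤ t) →
    q (+ suc (suc (suc t))) (bs ∷ʳ suc (suc t)) ≡ q (+ suc t) bs ℤ.+ + 2 ℤ.* q (+ t) bs
  q-house-then-edge t bs below = begin
    q (+ suc (suc (suc t))) (bs ∷ʳ suc (suc t))
      ≡⟨ q-glued house-then-edge house-then-edge-certified
                 (ℕₚ.n<1+n _ ∷ ℕₚ.n<1+n _ ∷ ℕₚ.m≤m+n _ _ ∷ ℕₚ.n<1+n _ ∷ [-]) refl ⟩
    coveredCoeff P house-then-edge ℤ.* q (+ t) bs ℤ.+ uncoveredCoeff P house-then-edge ℤ.* q (+ suc t) bs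
      ≡⟨ cong₂ (λ a b → a ℤ.* q (+ t) bs ℤ.+ b ℤ.* q (+ suc t) bs) house-then-edge-covered house-then-edge-uncovered ⟩
    + 2 ℤ.* q (+ t) bs ℤ.+ + 1 ℤ.* q (+ suc t) bs
      ≡⟨ house-then-edge-coefficients (q (+ t) bs) (q (+ suc t) bs) ⟩
    q (+ suc t) bs ℤ.+ + 2 ℤ.* q (+ t) bs ∎
    where
    open ≡-Reasoning
    open GluedPiece t 2 bs [ suc (suc t) ] below

  q-lone-house : ∀ t bs → (∀ b → b ∈ bs → b ≤ t) →
    q (+ suc (suc t)) (bs ∷ʳ suc (suc t)) ≡ ℤ.- (+ 2) ℤ.* q (+ suc t) bs ℤ.- + 3 ℤ.* q (+ t) bs
  q-lone-house t bs below = begin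
    q (+ suc (suc t)) (bs ∷ʳ suc (suc t))
      ≡⟨ q-glued lone-house lone-house-certified (ℕₚ.n<1+n _ ∷ ℕₚ.m≤m+n _ _ ∷ ℕₚ.n<1+n _ ∷ [-]) refl ⟩
    coveredCoeff P lone-house ℤ.* q (+ t) bs ℤ.+ uncoveredCoeff P lone-house ℤ.* q (+ suc t) bs
      ≡⟨ cong₂ (λ a b → a ℤ.* q (+ t) bs ℤ.+ b ℤ.* q (+ suc t) bs) lone-house-covered lone-house-uncovered ⟩
    ℤ.- (+ 3) ℤ.* q (+ t) bs ℤ.+ ℤ.- (+ 2) ℤ.* q (+ suc t) bs
      ≡⟨ lone-house-coefficients (q (+ t) bs) (q (+ suc t) bs) ⟩
    ℤ.- (+ 2) ℤ.* q (+ suc t) bs ℤ.- + 3 ℤ.* q (+ t) bs ∎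
    where
    open ≡-Reasoning
    open GluedPiece t 1 bs [ suc (suc t) ] below

  last-house-positive : ∀ {r} bs {ak} → InRange r (bs ∷ʳ ak) → 1 ≤ ak
  last-house-positive [] (ir1 _ _ 1≤ak _ _) = 1≤ak
  last-house-positive (b ∷ bs) (ir1 _ _ _ _ rest) = last-house-positive bs rest

  houses-before-last : ∀ bs ak → Gaps (bs ∷ʳ ak) → ∀ b → b ∈ bs → b + 2 ≤ ak
  houses-before-last (c ∷ []) ak (g2 _ _ _ c+2≤ak _) .c (here refl) = c+2≤ak
  houses-before-last (c ∷ d ∷ bs) ak (g2 _ _ _ c+2≤d gaps) b (here refl) =
    ℕₚ.≤-trans c+2≤d (ℕₚ.≤-trans (ℕₚ.m≤m+n d 2) (houses-before-last (d ∷ bs) ak gaps d (here refl)))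
  houses-before-last (c ∷ d ∷ bs) ak (g2 _ _ _ _ gaps) b (there b∈) = houses-before-last (d ∷ bs) ak gaps b b∈

  houses≤last : ∀ bs ak → Gaps (bs ∷ʳ ak) → ∀ a → a ∈ bs ∷ʳ ak → a ≤ ak
  houses≤last bs ak gaps a a∈ with ∈-++⁻ bs a∈
  ... | inj₁ a∈bs = ℕₚ.≤-trans (ℕₚ.m≤m+n a 2) (houses-before-last bs ak gaps a a∈bs)
  ... | inj₂ (here refl) = ℕₚ.≤-refl

  houses-below-last : ∀ bs t → Gaps (bs ∷ʳ suc (suc t)) → ∀ b → b ∈ bs → b ≤ t
  houses-below-last bs t gaps b b∈ with subst (_≤ suc (suc t)) (ℕₚ.+-comm b 2) (houses-before-last bs _ gaps b b∈)
  ... | s≤s (s≤s b≤t) = b≤t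

  no-house-before-first-edge : ∀ bs → Gaps (bs ∷ʳ 1) → bs ≡ []
  no-house-before-first-edge [] _ = refl
  no-house-before-first-edge (b ∷ bs) gaps with ℕₚ.≤-trans (ℕₚ.m≤n+m 2 b) (houses-before-last (b ∷ bs) 1 gaps b (here refl))
  ... | s≤s ()

  q-without-houses : ∀ (r : ℤ) → + 2 ℤ.≤ r → q r [] ≡ ℤ.- q (r ℤ.- + 2) []
  q-without-houses (+ suc (suc t)) (ℤ.+≤+ (s≤s (s≤s z≤n))) = q-pendant t [] (λ _ ())

  q-last-house-far-from-end : ∀ (r : ℤ) (bs : List ℕ) (ak : ℕ) → Admissible r (bs ∷ʳ ak) → + ak ℤ.+ + 2 ℤ.≤ r →
    q r (bs ∷ʳ ak) ≡ ℤ.- q (r ℤ.- + 2) (bs ∷ʳ ak)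
  q-last-house-far-from-end (+ n) bs ak (_ , _ , gaps) (ℤ.+≤+ ak+2≤n) = far n (subst (_≤ n) (ℕₚ.+-comm ak 2) ak+2≤n)
    where
    far : ∀ n → suc (suc ak) ≤ n → q (+ n) (bs ∷ʳ ak) ≡ ℤ.- q (+ n ℤ.- + 2) (bs ∷ʳ ak)
    far (suc (suc t)) (s≤s (s≤s ak≤t)) = q-pendant t (bs ∷ʳ ak) (λ a a∈ → ℕₚ.≤-trans (houses≤last bs ak gaps a a∈) ak≤t)

  q-last-house-on-penultimate-edge : ∀ (r : ℤ) (bs : List ℕ) (ak : ℕ) → Admissible r (bs ∷ʳ ak) → r ≡ + ak ℤ.+ + 1 →
    q r (bs ∷ʳ ak) ≡ q (r ℤ.- + 2) bs ℤ.+ + 2 ℤ.* q (r ℤ.- + 3) bs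
  q-last-house-on-penultimate-edge r bs ak (_ , in-range , gaps) r≡ =
    subst (λ r → q r (bs ∷ʳ ak) ≡ q (r ℤ.- + 2) bs ℤ.+ + 2 ℤ.* q (r ℤ.- + 3) bs)
          (sym (trans r≡ (cong +_ (ℕₚ.+-comm ak 1))))
          (after bs ak (last-house-positive bs in-range) gaps)
    where
    after : ∀ bs ak → 1 ≤ ak → Gaps (bs ∷ʳ ak) →
      q (+ suc ak) (bs ∷ʳ ak) ≡ q (+ suc ak ℤ.- + 2) bs ℤ.+ + 2 ℤ.* q (+ suc ak ℤ.- + 3) bs
    -- For a_k = 1 nothing lies left of the cut, and Q itself is small enough to evaluate.
    after bs 1 _ gaps rewrite no-house-before-first-edge bs gaps = trans {j = + 2} refl refl
    after bs (suc (suc t)) _ gaps = q-house-then-edge t bs (houses-below-last bs t gaps)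

  q-last-house-on-last-edge : ∀ (r : ℤ) (bs : List ℕ) (ak : ℕ) → Admissible r (bs ∷ʳ ak) → r ≡ + ak →
    q r (bs ∷ʳ ak) ≡ ℤ.- (+ 2) ℤ.* q (r ℤ.- + 1) bs ℤ.- + 3 ℤ.* q (r ℤ.- + 2) bs
  q-last-house-on-last-edge r bs ak (_ , in-range , gaps) r≡ =
    subst (λ r → q r (bs ∷ʳ ak) ≡ ℤ.- (+ 2) ℤ.* q (r ℤ.- + 1) bs ℤ.- + 3 ℤ.* q (r ℤ.- + 2) bs)
          (sym r≡) (at bs ak (last-house-positive bs in-range) gaps)
    where
    at : ∀ bs ak → 1 ≤ ak → Gaps (bs ∷ʳ ak) →
      q (+ ak) (bs ∷ʳ ak) ≡ ℤ.- (+ 2) ℤ.* q (+ ak ℤ.- + 1) bs ℤ.- + 3 ℤ.* q (+ ak ℤ.- + 2) bs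
    at bs 1 _ gaps rewrite no-house-before-first-edge bs gaps = trans {j = ℤ.- (+ 3)} refl refl
    at bs (suc (suc t)) _ gaps = q-lone-house t bs (houses-below-last bs t gaps)

open import Defs
open import Data.Nat using (ℕ)
open import Data.List using (List; []; _∷ʳ_)
open import Data.Product using (_×_; _,_)
open import Data.Integer using (ℤ; +_; -[1+_]; _+_; _-_; _*_; -_; _≤_)
open import Relation.Binary.PropositionalEquality using (_≡_; refl)
open PathsWithHouses
  using (q-without-houses; q-last-house-far-from-end; q-last-house-on-penultimate-edge; q-last-house-on-last-edge)

lemma6p6 :
  (q -[1+ 0 ] [] ≡ + 1 × q (+ 0) [] ≡ + 0)
  × (∀ (r : ℤ) → + 2 ≤ r → q r [] ≡ - q (r - + 2) [])
  × (∀ (r : ℤ) (bs : List ℕ) (ak : ℕ) → Admissible r (bs ∷ʳ ak) → + ak + + 2 ≤ r →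
       q r (bs ∷ʳ ak) ≡ - q (r - + 2) (bs ∷ʳ ak))
  × (∀ (r : ℤ) (bs : List ℕ) (ak : ℕ) → Admissible r (bs ∷ʳ ak) → r ≡ + ak + + 1 →
       q r (bs ∷ʳ ak) ≡ q (r - + 2) bs + + 2 * q (r - + 3) bs)
  × (∀ (r : ℤ) (bs : List ℕ) (ak : ℕ) → Admissible r (bs ∷ʳ ak) → r ≡ + ak →
       q r (bs ∷ʳ ak) ≡ - (+ 2) * q (r - + 1) bs - + 3 * q (r - + 2) bs)
lemma6p6 = (refl , refl) , q-without-houses , q-last-house-far-from-end
         , q-last-house-on-penultimate-edge , q-last-house-on-last-edge
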